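{- There exist constants $c>0$ and $s_0$ such that for every $(3,3)'$-system $(H,\mathcal{F})$ with $|V(H)|=m$, $e(H)=e$ and $|\mathcal{F}|=s\ge s_0$, we have $e \geq c\, m^{1/2} s$.
   Context: All graphs are finite and simple; $e(H)$ is the number of edges. A $(3,3)'$-system is a pair $(H,\mathcal{F})$ where $H$ is a triangle-free graph and $\mathcal{F}$ is a family (without repeated elements) of subsets of $V(H)$, each of size exactly $3$ and each a maximal independent set of $H$. -}

module Defs where

open import Data.Nat using (ℕ; _<ᵇ_)
open import Data.Bool using (Bool; true; false; _∧_; if_then_else_)
open import Data.Fin using (Fin; toℕ)
open import Data.Fin.Subset using (Subset; _∈_; _∉_; ∣_∣)
open import Data.List using (List; map; allFin)
open import Data.Nat.ListAction using (sum)
open import Data.List.Relation.Unary.All using (All)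
open import Data.List.Relation.Unary.Unique.Propositional using (Unique)
open import Data.Product using (_×_; ∃)
open import Data.Empty using (⊥)
open import Relation.Binary.PropositionalEquality using (_≡_)

record Graph (m : ℕ) : Set where
  field
    adj    : Fin m → Fin m → Bool
    sym    : ∀ i j → adj i j ≡ adj j i
    irrefl : ∀ i → adj i i ≡ false
open Graph public

edgeCount : ∀ {m} → Graph m → ℕ
edgeCount {m} G =
  sum (map (λ i → sum (map (λ j → if (toℕ i <ᵇ toℕ j) ∧ adj G i j then 1 else 0)
                           (allFin m)))
           (allFin m))

TriangleFree : ∀ {m} → Graph m → Set
TriangleFree G = ∀ i j k → adj G i j ≡ true → adj G j k ≡ true → adj G i k ≡ true → ⊥

Independent : ∀ {m} → Graph m → Subset m → Set
Independent G S = ∀ i j → i ∈ S → j ∈ S → adj G i j ≡ false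

MaximalIndependent : ∀ {m} → Graph m → Subset m → Set
MaximalIndependent G S = Independent G S × (∀ v → v ∉ S → ∃ λ u → u ∈ S × adj G u v ≡ true)

record System33 (m : ℕ) : Set where
  field
    H            : Graph m
    triangleFree : TriangleFree H
    family       : List (Subset m)
    noRepeats    : Unique family
    members      : All (λ S → ∣ S ∣ ≡ 3 × MaximalIndependent H S) family
open System33 public

{-# OPTIONS --safe #-}
module Submission where

-- Let E = 2e be the degree sum and M = m − 3. A maximal independent triple dominates the
-- graph, so M ≤ E, and every triple contains a high vertex (degree ≥ M/3), of which there
-- are at most 3E/M. Two vertices lie in at most two common triples, since otherwise the
-- three remaining vertices would form a triangle. Fix one triple {a, b, c}: the vertices
-- other than c fall into three independent parts (essentially the neighbourhoods of a, b
-- and c), so every triple contains c, or meets some part in two or three vertices, or is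
-- rainbow (one vertex in each part). Each of these counts x obeys M x² ≤ p E² + q E x with
-- p + q ≤ 21 < M, whence x √M ≤ α E once α² ≥ p + q. A triple inside a part is the whole
-- part; a triple meeting a part P in exactly two vertices is determined by its third
-- vertex, whose degree is at least |P| − 2, and at most 2|P| + 1 such triples pass through
-- any vertex; two rainbow triples through a common vertex z yield an edge between them
-- that determines z and both triples, which bounds the rainbow triples by Cauchy–Schwarz
-- over the high vertices. Summing the eight bounds gives s √M ≤ 25 E.

open import Defs using (Graph; adj; TriangleFree; MaximalIndependent; edgeCount; System33; H; family; triangleFree; noRepeats; members)

open import Data.Bool.Base using (Bool; true; false; _∧_; _∨_; not; if_then_else_) renaming (T to IsTrue)
open import Data.Bool.Properties as Bool using (∧-zeroʳ; ∧-identityʳ)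
open import Data.Empty using (⊥; ⊥-elim)
open import Data.Fin.Base using (Fin; zero; suc; toℕ; fromℕ<)
open import Data.Fin.Properties as Fin using (_≟_; toℕ-injective; any?)
open import Data.Fin.Subset using (Subset; ∣_∣)
open import Data.List.Base as List using (length)
open import Data.List.Membership.Propositional.Properties using (∈-lookup)
open import Data.List.Properties using (map-tabulate)
import Data.List.Relation.Unary.All as All
open import Data.List.Relation.Unary.AllPairs using (_∷_)
open import Data.List.Relation.Unary.Unique.Propositional using (Unique)
open import Data.Nat.Base
import Data.Nat.ListAction as ListAction
open import Data.Nat.Properties hiding (_≟_)
open import Data.Nat.Tactic.RingSolver using (solve-∀)
open import Data.Product.Base using (_×_; _,_; ∃; proj₁; proj₂)
open import Data.Sum.Base using (_⊎_; inj₁; inj₂; [_,_]′)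
open import Data.Vec.Base as Vec using ([]; _∷_)
open import Data.Vec.Properties using (tabulate∘lookup; tabulate-cong; lookup⇒[]=; []=⇒lookup)
open import Function.Base using (id; _∘_; case_of_)
open import Relation.Binary.PropositionalEquality
open import Relation.Nullary.Decidable using (yes; no; does; _×-dec_)
open import Relation.Nullary.Reflects using (ofʸ; ofⁿ)
open import Algebra.Properties.Semiring.Sum +-*-semiring
  using (sum; sum-syntax; sum-cong-≗; ∑-distrib-+; ∑-comm; *-distribˡ-sum; *-distribʳ-sum)

-- Counting with Iverson brackets

true≢false : ∀ {b} → b ≡ true → b ≢ false
true≢false refl ()

∧-true⁻ : ∀ {a b} → a ∧ b ≡ true → a ≡ true × b ≡ true
∧-true⁻ {true} b≡true = refl , b≡true

∧-true⁺ : ∀ {a b} → a ≡ true → b ≡ true → a ∧ b ≡ true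
∧-true⁺ refl b≡true = b≡true

not≡true⇒≡false : ∀ {a} → not a ≡ true → a ≡ false
not≡true⇒≡false {false} _ = refl

≡ᵇ≡true⇒≡ : ∀ {a b} → (a ≡ᵇ b) ≡ true → a ≡ b
≡ᵇ≡true⇒≡ {a} {b} e = ≡ᵇ⇒≡ a b (subst IsTrue (sym e) _)

≤⇒≤ᵇ≡true : ∀ {a b} → a ≤ b → (a ≤ᵇ b) ≡ true
≤⇒≤ᵇ≡true {a} {b} a≤b with a ≤ᵇ b | ≤ᵇ-reflects-≤ a b
... | true  | _      = refl
... | false | ofⁿ a≰b = ⊥-elim (a≰b a≤b)

≤ᵇ≡true⇒≤ : ∀ {a b} → (a ≤ᵇ b) ≡ true → a ≤ b
≤ᵇ≡true⇒≤ {a} {b} e with a ≤ᵇ b | ≤ᵇ-reflects-≤ a b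
... | true | ofʸ a≤b = a≤b

⟦_⟧ : Bool → ℕ
⟦ true  ⟧ = 1
⟦ false ⟧ = 0

count : ∀ {n} → (Fin n → Bool) → ℕ
count {n} P = ∑[ i < n ] ⟦ P i ⟧

⟦⟧≤1 : ∀ b → ⟦ b ⟧ ≤ 1
⟦⟧≤1 true  = s≤s z≤n
⟦⟧≤1 false = z≤n

⟦⟧>0⇒true : ∀ {b} → 0 < ⟦ b ⟧ → b ≡ true
⟦⟧>0⇒true {true} _ = refl

⟦⟧≤ : ∀ b {n} → (b ≡ true → 1 ≤ n) → ⟦ b ⟧ ≤ n
⟦⟧≤ true  1≤n = 1≤n refl
⟦⟧≤ false _   = z≤n

⟦∧⟧ : ∀ a b → ⟦ a ∧ b ⟧ ≡ ⟦ a ⟧ * ⟦ b ⟧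
⟦∧⟧ true  b = sym (+-identityʳ ⟦ b ⟧)
⟦∧⟧ false b = refl

⟦⟧*-≤ : ∀ b x → ⟦ b ⟧ * x ≤ x
⟦⟧*-≤ true  x = ≤-reflexive (+-identityʳ x)
⟦⟧*-≤ false x = z≤n

∑-mono-≤ : ∀ {n} {f g : Fin n → ℕ} → (∀ i → f i ≤ g i) → ∑[ i < n ] f i ≤ ∑[ i < n ] g i
∑-mono-≤ {zero}  _   = z≤n
∑-mono-≤ {suc n} f≤g = +-mono-≤ (f≤g zero) (∑-mono-≤ (f≤g ∘ suc))

∑-zero : ∀ {n} {f : Fin n → ℕ} → (∀ i → f i ≡ 0) → ∑[ i < n ] f i ≡ 0
∑-zero {zero}  _    = refl
∑-zero {suc n} f≡0 = cong₂ _+_ (f≡0 zero) (∑-zero (f≡0 ∘ suc))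

∑-const : ∀ n c → ∑[ i < n ] c ≡ n * c
∑-const zero    c = refl
∑-const (suc n) c = cong (c +_) (∑-const n c)

term≤∑ : ∀ {n} (f : Fin n → ℕ) i → f i ≤ ∑[ j < n ] f j
term≤∑ f zero    = m≤m+n _ _
term≤∑ f (suc i) = ≤-trans (term≤∑ (f ∘ suc) i) (m≤n+m _ _)

∑-positive : ∀ {n} (f : Fin n → ℕ) → 0 < ∑[ i < n ] f i → ∃ λ i → 0 < f i
∑-positive {suc n} f ∑>0 with f zero in eq
... | suc _ = zero , subst (0 <_) (sym eq) z<s
... | zero  = let i , fi>0 = ∑-positive (f ∘ suc) ∑>0 in suc i , fi>0

∑-≤1 : ∀ {n} {f : Fin n → ℕ} → (∀ i → f i ≤ 1) → (∀ i j → 0 < f i → 0 < f j → i ≡ j) →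
       ∑[ i < n ] f i ≤ 1
∑-≤1 {zero}      _    _   = z≤n
∑-≤1 {suc n} {f} f≤1 uniq with f zero in eq
... | zero  = ∑-≤1 (f≤1 ∘ suc) (λ i j fi>0 fj>0 → Fin.suc-injective (uniq (suc i) (suc j) fi>0 fj>0))
... | suc _ = +-mono-≤ (subst (_≤ 1) eq (f≤1 zero)) (≤-reflexive (∑-zero rest≡0))
  where
  rest≡0 : ∀ i → f (suc i) ≡ 0
  rest≡0 i = n≤0⇒n≡0 (≮⇒≥ λ fi>0 → case uniq zero (suc i) (subst (0 <_) (sym eq) z<s) fi>0 of λ ())

∑-comm₄ : ∀ {a b c d} (f : Fin a → Fin b → Fin c → Fin d → ℕ) →
          ∑[ i < a ] ∑[ j < b ] ∑[ k < c ] ∑[ l < d ] f i j k l ≡ ∑[ k < c ] ∑[ l < d ] ∑[ i < a ] ∑[ j < b ] f i j k l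
∑-comm₄ {a} {b} {c} {d} f = begin
  ∑[ i < a ] ∑[ j < b ] ∑[ k < c ] ∑[ l < d ] f i j k l ≡⟨ sum-cong-≗ {a} (λ i → ∑-comm (λ j k → ∑[ l < d ] f i j k l)) ⟩
  ∑[ i < a ] ∑[ k < c ] ∑[ j < b ] ∑[ l < d ] f i j k l ≡⟨ sum-cong-≗ {a} (λ i → sum-cong-≗ {c} λ k → ∑-comm (λ j l → f i j k l)) ⟩
  ∑[ i < a ] ∑[ k < c ] ∑[ l < d ] ∑[ j < b ] f i j k l ≡⟨ ∑-comm (λ i k → ∑[ l < d ] ∑[ j < b ] f i j k l) ⟩
  ∑[ k < c ] ∑[ i < a ] ∑[ l < d ] ∑[ j < b ] f i j k l ≡⟨ sum-cong-≗ {c} (λ k → ∑-comm (λ i l → ∑[ j < b ] f i j k l)) ⟩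
  ∑[ k < c ] ∑[ l < d ] ∑[ i < a ] ∑[ j < b ] f i j k l ∎
  where open ≡-Reasoning

∑-*-∑ : ∀ {n} (a b : Fin n → ℕ) → (∑[ i < n ] a i) * (∑[ j < n ] b j) ≡ ∑[ i < n ] ∑[ j < n ] (a i * b j)
∑-*-∑ {n} a b = trans (*-distribʳ-sum (sum b) a) (sum-cong-≗ {n} λ i → *-distribˡ-sum (a i) b)

∑∑-scaled-product : ∀ {n} c (a b : Fin n → ℕ) → ∑[ i < n ] ∑[ j < n ] (c * (a i * b j)) ≡ c * (sum a * sum b)
∑∑-scaled-product {n} c a b = begin
  ∑[ i < n ] ∑[ j < n ] (c * (a i * b j))   ≡⟨ sum-cong-≗ {n} (λ i → *-distribˡ-sum c (λ j → a i * b j)) ⟨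
  ∑[ i < n ] (c * ∑[ j < n ] (a i * b j))   ≡⟨ *-distribˡ-sum c (λ i → ∑[ j < n ] (a i * b j)) ⟨
  c * ∑[ i < n ] ∑[ j < n ] (a i * b j)     ≡⟨ cong (c *_) (∑-*-∑ a b) ⟨
  c * (sum a * sum b)                       ∎
  where open ≡-Reasoning

module _ {n : ℕ} where

  count-witness : (P : Fin n → Bool) → 0 < count P → ∃ λ i → P i ≡ true
  count-witness P count>0 = let i , ⟦Pi⟧>0 = ∑-positive (⟦_⟧ ∘ P) count>0 in i , ⟦⟧>0⇒true ⟦Pi⟧>0

  count-positive : (P : Fin n → Bool) {i : Fin n} → P i ≡ true → 0 < count P
  count-positive P {i} Pi = subst (_≤ count P) (cong ⟦_⟧ Pi) (term≤∑ (⟦_⟧ ∘ P) i)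

  count≡0⇒false : (P : Fin n → Bool) → count P ≡ 0 → ∀ i → P i ≡ false
  count≡0⇒false P count≡0 i with P i in Pi
  ... | false = refl
  ... | true  = case subst (0 <_) count≡0 (count-positive P Pi) of λ ()

  count-≤1 : (P : Fin n → Bool) → (∀ i j → P i ≡ true → P j ≡ true → i ≡ j) → count P ≤ 1
  count-≤1 P uniq = ∑-≤1 (⟦⟧≤1 ∘ P) (λ i j Pi Pj → uniq i j (⟦⟧>0⇒true Pi) (⟦⟧>0⇒true Pj))

  count-mono : {P Q : Fin n → Bool} → (∀ i → P i ≡ true → Q i ≡ true) → count P ≤ count Q
  count-mono {P} {Q} P⊆Q = ∑-mono-≤ λ i → ⟦⟧≤ (P i) λ Pi → subst (λ b → 1 ≤ ⟦ b ⟧) (sym (P⊆Q i Pi)) ≤-refl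

  count-split : (P Q : Fin n → Bool) →
                count P ≡ count (λ i → P i ∧ Q i) + count (λ i → P i ∧ not (Q i))
  count-split P Q = trans (sum-cong-≗ {n} split) (∑-distrib-+ {n} _ _)
    where
    split : ∀ i → ⟦ P i ⟧ ≡ ⟦ P i ∧ Q i ⟧ + ⟦ P i ∧ not (Q i) ⟧
    split i with P i | Q i
    ... | true  | true  = refl
    ... | true  | false = refl
    ... | false | _     = refl

  _∖_ : (Fin n → Bool) → Fin n → Fin n → Bool
  (P ∖ i) j = P j ∧ not (does (j ≟ i))

  ∖-⊆ : ∀ P {i j} → (P ∖ i) j ≡ true → P j ≡ true
  ∖-⊆ P {i} {j} e with P j
  ... | true = refl

  ∖-≢ : ∀ P {i j} → (P ∖ i) j ≡ true → j ≢ i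
  ∖-≢ P {i} {j} e with P j | j ≟ i
  ... | true | no j≢i = j≢i

  ∖-intro : ∀ P {i j} → P j ≡ true → j ≢ i → (P ∖ i) j ≡ true
  ∖-intro P {i} {j} Pj j≢i with j ≟ i
  ... | yes j≡i = ⊥-elim (j≢i j≡i)
  ... | no  _   = trans (∧-identityʳ (P j)) Pj

count-at : ∀ {n} (P : Fin n → Bool) i → count (λ j → P j ∧ does (j ≟ i)) ≡ ⟦ P i ⟧
count-at {suc n} P zero    = trans (cong (⟦ P zero ∧ true ⟧ +_) (∑-zero {n} λ j → cong ⟦_⟧ (∧-zeroʳ (P (suc j)))))
                                   (trans (+-identityʳ _) (cong ⟦_⟧ (∧-identityʳ (P zero))))
count-at {suc n} P (suc i) = trans (cong (_+ count (λ j → P (suc j) ∧ does (j ≟ i))) (cong ⟦_⟧ (∧-zeroʳ (P zero))))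
                                   (count-at (P ∘ suc) i)

count-∖ : ∀ {n} (P : Fin n → Bool) {i} → P i ≡ true → count P ≡ suc (count (P ∖ i))
count-∖ P {i} Pi = trans (count-split P (λ j → does (j ≟ i)))
                         (cong (_+ count (P ∖ i)) (trans (count-at P i) (cong ⟦_⟧ Pi)))

module _ {n : ℕ} (P : Fin n → Bool) where

  count-∖∖ : ∀ {x y} → P x ≡ true → P y ≡ true → x ≢ y → count P ≡ 2 + count ((P ∖ x) ∖ y)
  count-∖∖ {x} Px Py x≢y = trans (count-∖ P Px) (cong suc (count-∖ (P ∖ x) (∖-intro P Py (x≢y ∘ sym))))

  count≡1⇒unique : count P ≡ 1 → ∀ {i j} → P i ≡ true → P j ≡ true → i ≡ j
  count≡1⇒unique count≡1 {i} {j} Pi Pj with j ≟ i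
  ... | yes j≡i = sym j≡i
  ... | no  j≢i = ⊥-elim (true≢false (∖-intro P Pj j≢i)
                    (count≡0⇒false (P ∖ i) (suc-injective (trans (sym (count-∖ P Pi)) count≡1)) j))

  count≥3⇒members : 3 ≤ count P → ∃ λ x → ∃ λ y → ∃ λ z →
                    P x ≡ true × P y ≡ true × P z ≡ true × x ≢ y × x ≢ z × y ≢ z
  count≥3⇒members 3≤count =
    let x , Px = count-witness P (≤-trans (s≤s z≤n) 3≤count)
        y , y∈ = count-witness (P ∖ x) (≤-pred (≤-trans (s≤s (s≤s z≤n)) (subst (3 ≤_) (count-∖ P Px) 3≤count)))
        Py = ∖-⊆ P y∈
        x≢y = ∖-≢ P y∈ ∘ sym
        z , z∈ = count-witness ((P ∖ x) ∖ y) (≤-pred (≤-pred (subst (3 ≤_) (count-∖∖ Px Py x≢y) 3≤count)))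
    in x , y , z , Px , Py , ∖-⊆ P (∖-⊆ (P ∖ x) z∈) , x≢y , ∖-≢ P (∖-⊆ (P ∖ x) z∈) ∘ sym , ∖-≢ (P ∖ x) z∈ ∘ sym

  module _ (count≡3 : count P ≡ 3) where

    count≡3⇒third : ∀ {x y} → P x ≡ true → P y ≡ true → x ≢ y → ∃ λ z → P z ≡ true × z ≢ x × z ≢ y
    count≡3⇒third {x} {y} Px Py x≢y =
      let z , z∈ = count-witness ((P ∖ x) ∖ y) (≤-pred (≤-pred (subst (3 ≤_) (count-∖∖ Px Py x≢y) (≤-reflexive (sym count≡3)))))
      in z , ∖-⊆ P (∖-⊆ (P ∖ x) z∈) , ∖-≢ P (∖-⊆ (P ∖ x) z∈) , ∖-≢ (P ∖ x) z∈

    count≡3⇒only : ∀ {x y z} → P x ≡ true → P y ≡ true → P z ≡ true → x ≢ y → x ≢ z → y ≢ z →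
                   ∀ w → P w ≡ true → w ≡ x ⊎ w ≡ y ⊎ w ≡ z
    count≡3⇒only {x} {y} {z} Px Py Pz x≢y x≢z y≢z w Pw with w ≟ x | w ≟ y | w ≟ z
    ... | yes w≡x | _       | _       = inj₁ w≡x
    ... | no  _   | yes w≡y | _       = inj₂ (inj₁ w≡y)
    ... | no  _   | no  _   | yes w≡z = inj₂ (inj₂ w≡z)
    ... | no  w≢x | no  w≢y | no  w≢z =
      ⊥-elim (true≢false (∖-intro ((P ∖ x) ∖ y) (∖-intro (P ∖ x) (∖-intro P Pw w≢x) w≢y) w≢z) (count≡0⇒false _ none-left w))
      where
      Pz′ = ∖-intro (P ∖ x) (∖-intro P Pz (x≢z ∘ sym)) (y≢z ∘ sym)
      none-left : count (((P ∖ x) ∖ y) ∖ z) ≡ 0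
      none-left = suc-injective (suc-injective (suc-injective
        (trans (sym (trans (count-∖∖ Px Py x≢y) (cong (2 +_) (count-∖ ((P ∖ x) ∖ y) Pz′)))) count≡3)))

  ∑-ordered-pairs : ∑[ i < n ] (⟦ P i ⟧ * count (P ∖ i)) ≡ count P * (count P ∸ 1)
  ∑-ordered-pairs = trans (sum-cong-≗ {n} pointwise) (sym (*-distribʳ-sum (count P ∸ 1) (⟦_⟧ ∘ P)))
    where
    pointwise : ∀ i → ⟦ P i ⟧ * count (P ∖ i) ≡ ⟦ P i ⟧ * (count P ∸ 1)
    pointwise i with P i in Pi
    ... | false = refl
    ... | true  = cong (1 *_) (cong (_∸ 1) (sym (count-∖ P Pi)))

count≤∑witnesses : ∀ {a b} {P : Fin a → Bool} {Q : Fin b → Bool} (R : Fin a → Fin b → Bool) →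
                    (∀ x → P x ≡ true → ∃ λ y → Q y ≡ true × R x y ≡ true) →
                    count P ≤ ∑[ y < b ] (⟦ Q y ⟧ * count (λ x → R x y))
count≤∑witnesses {a} {b} {P} {Q} R witness = begin
  count P                                          ≤⟨ ∑-mono-≤ (λ x → ⟦⟧≤ (P x) (one x)) ⟩
  ∑[ x < a ] ∑[ y < b ] (⟦ Q y ⟧ * ⟦ R x y ⟧)      ≡⟨ ∑-comm (λ x y → ⟦ Q y ⟧ * ⟦ R x y ⟧) ⟩
  ∑[ y < b ] ∑[ x < a ] (⟦ Q y ⟧ * ⟦ R x y ⟧)      ≡⟨ sum-cong-≗ {b} (λ y → *-distribˡ-sum ⟦ Q y ⟧ (λ x → ⟦ R x y ⟧)) ⟨
  ∑[ y < b ] (⟦ Q y ⟧ * count (λ x → R x y))       ∎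
  where
  open ≤-Reasoning
  one : ∀ x → P x ≡ true → 1 ≤ ∑[ y < b ] (⟦ Q y ⟧ * ⟦ R x y ⟧)
  one x Px = let y , Qy , Rxy = witness x Px in
    ≤-trans (≤-reflexive (sym (cong₂ (λ c d → ⟦ c ⟧ * ⟦ d ⟧) Qy Rxy))) (term≤∑ (λ y → ⟦ Q y ⟧ * ⟦ R x y ⟧) y)

module _ {a b c : ℕ} (P : Fin a → Fin b → Fin c → Bool) where

  ∑∑count-witness : 0 < ∑[ x < a ] ∑[ y < b ] count (P x y) → ∃ λ x → ∃ λ y → ∃ λ z → P x y z ≡ true
  ∑∑count-witness positive =
    let x , x-pos = ∑-positive (λ x → ∑[ y < b ] count (P x y)) positive
        y , y-pos = ∑-positive (λ y → count (P x y)) x-pos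
        z , Pxyz  = count-witness (P x y) y-pos
    in x , y , z , Pxyz

  ∑∑count-≤1 : (∀ {x y z x′ y′ z′} → P x y z ≡ true → P x′ y′ z′ ≡ true → x ≡ x′ × y ≡ y′ × z ≡ z′) →
               ∑[ x < a ] ∑[ y < b ] count (P x y) ≤ 1
  ∑∑count-≤1 unique = ∑-≤1 inner-≤1 λ x x′ x-pos x′-pos →
    let y , y-pos = ∑-positive (λ y → count (P x y)) x-pos
        y′ , y′-pos = ∑-positive (λ y → count (P x′ y)) x′-pos
    in unique (count-witness (P x y) y-pos .proj₂) (count-witness (P x′ y′) y′-pos .proj₂) .proj₁
    where
    inner-≤1 : ∀ x → ∑[ y < b ] count (P x y) ≤ 1
    inner-≤1 x = ∑-≤1 (λ y → count-≤1 (P x y) λ z z′ Pz Pz′ → unique Pz Pz′ .proj₂ .proj₂) λ y y′ y-pos y′-pos →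
      unique (count-witness (P x y) y-pos .proj₂) (count-witness (P x y′) y′-pos .proj₂) .proj₂ .proj₁

average-attained : ∀ {n} (P : Fin n → Bool) (x : Fin n → ℕ) {y} → 0 < count P →
                   y ≤ ∑[ i < n ] (⟦ P i ⟧ * x i) → ∃ λ i → P i ≡ true × y ≤ count P * x i
average-attained {n} P x {y} count>0 y≤∑ with any? (λ i → (P i Bool.≟ true) ×-dec (y ≤? count P * x i))
... | yes (i , Pi , large) = i , Pi , large
... | no none with y
...   | zero  = let i , Pi = count-witness P count>0 in i , Pi , z≤n
...   | suc y′ = ⊥-elim (<⇒≱ (*-monoʳ-< (count P) {{>-nonZero count>0}} (n<1+n y′)) (begin
  count P * suc y′                              ≤⟨ *-monoʳ-≤ (count P) y≤∑ ⟩
  count P * ∑[ i < n ] (⟦ P i ⟧ * x i)          ≡⟨ *-distribˡ-sum (count P) (λ i → ⟦ P i ⟧ * x i) ⟩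
  ∑[ i < n ] (count P * (⟦ P i ⟧ * x i))        ≤⟨ ∑-mono-≤ small ⟩
  ∑[ i < n ] (⟦ P i ⟧ * y′)                     ≡⟨ *-distribʳ-sum y′ (⟦_⟧ ∘ P) ⟨
  count P * y′                                  ∎))
  where
  open ≤-Reasoning
  small : ∀ i → count P * (⟦ P i ⟧ * x i) ≤ ⟦ P i ⟧ * y′
  small i with P i in Pi
  ... | false = ≤-reflexive (*-zeroʳ (count P))
  ... | true  = subst₂ _≤_ (cong (count P *_) (sym (+-identityʳ (x i)))) (sym (+-identityʳ y′))
                       (≤-pred (≰⇒> λ large → none (i , Pi , large)))


-- Arithmetic

2xy≤x²+y² : ∀ x y → 2 * (x * y) ≤ x * x + y * y
2xy≤x²+y² x y = [ ordered , (λ y≤x → subst₂ _≤_ (cong (2 *_) (*-comm y x)) (+-comm (y * y) (x * x)) (ordered y≤x)) ]′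
                (≤-total x y)
  where
  ordered : ∀ {x y} → x ≤ y → 2 * (x * y) ≤ x * x + y * y
  ordered {x} x≤y with d , refl ← m≤n⇒∃[o]m+o≡n x≤y =
    subst (2 * (x * (x + d)) ≤_) (sym (square-gap x d)) (m≤m+n _ (d * d))
    where
    square-gap : ∀ x d → x * x + (x + d) * (x + d) ≡ 2 * (x * (x + d)) + d * d
    square-gap = solve-∀

cauchy-schwarz : ∀ {n} (w x : Fin n → ℕ) →
  (∑[ i < n ] (w i * x i)) * (∑[ i < n ] (w i * x i)) ≤ (∑[ i < n ] w i) * (∑[ i < n ] (w i * (x i * x i)))
cauchy-schwarz {n} w x = *-cancelˡ-≤ 2 (begin
  2 * (A * A)                                           ≡⟨ ∑∑-scaled-product 2 wx wx ⟨
  ∑[ i < n ] ∑[ j < n ] (2 * (wx i * wx j))             ≤⟨ ∑-mono-≤ (λ i → ∑-mono-≤ (pointwise i)) ⟩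
  ∑[ i < n ] ∑[ j < n ] (w i * wx² j + wx² i * w j)     ≡⟨ sum-cong-≗ {n} (λ i → ∑-distrib-+ (λ j → w i * wx² j) (λ j → wx² i * w j)) ⟩
  ∑[ i < n ] (∑[ j < n ] (w i * wx² j) + ∑[ j < n ] (wx² i * w j))
                                                        ≡⟨ ∑-distrib-+ (λ i → ∑[ j < n ] (w i * wx² j)) (λ i → ∑[ j < n ] (wx² i * w j)) ⟩
  ∑[ i < n ] ∑[ j < n ] (w i * wx² j) + ∑[ i < n ] ∑[ j < n ] (wx² i * w j)
                                                        ≡⟨ cong₂ _+_ (∑-*-∑ w wx²) (∑-*-∑ wx² w) ⟨
  W * Q + Q * W                                         ≡⟨ cong (W * Q +_) (*-comm Q W) ⟩
  W * Q + W * Q                                         ≡⟨ cong (W * Q +_) (+-identityʳ (W * Q)) ⟨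
  2 * (W * Q)                                           ∎)
  where
  open ≤-Reasoning
  wx wx² : Fin n → ℕ
  wx i = w i * x i
  wx² i = w i * (x i * x i)
  A W Q : ℕ
  A = sum wx
  W = sum w
  Q = sum wx²
  pointwise : ∀ i j → 2 * (wx i * wx j) ≤ w i * wx² j + wx² i * w j
  pointwise i j = begin
    2 * (wx i * wx j)                        ≡⟨ regroup (w i) (w j) (x i) (x j) ⟩
    w i * w j * (2 * (x i * x j))            ≤⟨ *-monoʳ-≤ (w i * w j) (2xy≤x²+y² (x i) (x j)) ⟩
    w i * w j * (x i * x i + x j * x j)      ≡⟨ expand (w i) (w j) (x i) (x j) ⟩
    w i * wx² j + wx² i * w j                ∎
    where
    regroup : ∀ a b c d → 2 * (a * c * (b * d)) ≡ a * b * (2 * (c * d))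
    regroup = solve-∀
    expand : ∀ a b c d → a * b * (c * c + d * d) ≡ a * (b * (d * d)) + a * (c * c) * b
    expand = solve-∀

n²≡n[n∸1]+n : ∀ n → n * n ≡ n * (n ∸ 1) + n
n²≡n[n∸1]+n zero    = refl
n²≡n[n∸1]+n (suc n) = trans (*-suc (suc n) n) (+-comm (suc n) (suc n * n))

square-cancel-≤ : ∀ {a b} → a * a ≤ b * b → a ≤ b
square-cancel-≤ a²≤b² = ≮⇒≥ λ b<a → <⇒≱ (*-mono-< b<a b<a) a²≤b²

module RootScale (M E : ℕ) where

  infix 4 _√M≤_E

  -- "a √M ≤ α E", squared so that it can be stated in ℕ.
  record _√M≤_E (a α : ℕ) : Set where
    constructor squared
    field
      squared-bound : M * (a * a) ≤ α * E * (α * E)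

  √M≤-mono : ∀ {a b α} → a ≤ b → b √M≤ α E → a √M≤ α E
  √M≤-mono a≤b (squared b-bound) = squared (≤-trans (*-monoʳ-≤ M (*-mono-≤ a≤b a≤b)) b-bound)

  √M≤-+ : ∀ {a b α β} → a √M≤ α E → b √M≤ β E → a + b √M≤ α + β E
  √M≤-+ {a} {b} {α} {β} (squared a-bound) (squared b-bound) = squared (begin
    M * ((a + b) * (a + b))                           ≡⟨ expand M a b ⟩
    M * (a * a) + 2 * (M * a * b) + M * (b * b)       ≤⟨ +-mono-≤ (+-mono-≤ a-bound (*-monoʳ-≤ 2 cross)) b-bound ⟩
    α * E * (α * E) + 2 * (α * E * (β * E)) + β * E * (β * E)
                                                      ≡⟨ expand′ α β E ⟩
    (α + β) * E * ((α + β) * E)                       ∎)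
    where
    open ≤-Reasoning
    expand : ∀ M a b → M * ((a + b) * (a + b)) ≡ M * (a * a) + 2 * (M * a * b) + M * (b * b)
    expand = solve-∀
    expand′ : ∀ α β E → α * E * (α * E) + 2 * (α * E * (β * E)) + β * E * (β * E) ≡ (α + β) * E * ((α + β) * E)
    expand′ = solve-∀
    regroup : ∀ M a b → M * a * b * (M * a * b) ≡ M * (a * a) * (M * (b * b))
    regroup = solve-∀
    regroup′ : ∀ x y → x * x * (y * y) ≡ x * y * (x * y)
    regroup′ = solve-∀
    cross : M * a * b ≤ α * E * (β * E)
    cross = square-cancel-≤ (begin
      M * a * b * (M * a * b)                         ≡⟨ regroup M a b ⟩
      M * (a * a) * (M * (b * b))                     ≤⟨ *-mono-≤ a-bound b-bound ⟩
      α * E * (α * E) * (β * E * (β * E))             ≡⟨ regroup′ (α * E) (β * E) ⟩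
      α * E * (β * E) * (α * E * (β * E))             ∎)

  √M≤-∑ : ∀ {n} {a α : Fin n → ℕ} → (∀ i → a i √M≤ α i E) → ∑[ i < n ] a i √M≤ ∑[ i < n ] α i E
  √M≤-∑ {zero}  _      = squared (≤-reflexive (*-zeroʳ M))
  √M≤-∑ {suc n} bounds = √M≤-+ (bounds zero) (√M≤-∑ (bounds ∘ suc))

  -- If a is larger than E, the hypothesis forces M ≤ p + q.
  quadratic⇒√M≤ : ∀ p q {α a} → p + q < M → p + q ≤ α * α →
                  M * (a * a) ≤ p * (E * E) + q * (E * a) → a √M≤ α E
  quadratic⇒√M≤ p q {α} {a} p+q<M p+q≤α² quadratic with a ≤? E
  ... | yes a≤E = squared (begin
    M * (a * a)                    ≤⟨ quadratic ⟩
    p * (E * E) + q * (E * a)      ≤⟨ +-monoʳ-≤ (p * (E * E)) (*-monoʳ-≤ q (*-monoʳ-≤ E a≤E)) ⟩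
    p * (E * E) + q * (E * E)      ≡⟨ *-distribʳ-+ (E * E) p q ⟨
    (p + q) * (E * E)              ≤⟨ *-monoˡ-≤ (E * E) p+q≤α² ⟩
    α * α * (E * E)                ≡⟨ regroup α E ⟩
    α * E * (α * E)                ∎)
    where
    open ≤-Reasoning
    regroup : ∀ α E → α * α * (E * E) ≡ α * E * (α * E)
    regroup = solve-∀
  ... | no a≰E = ⊥-elim (<⇒≱ p+q<M (*-cancelʳ-≤ M (p + q) (a * a) {{a²≢0}} (begin
    M * (a * a)                    ≤⟨ quadratic ⟩
    p * (E * E) + q * (E * a)      ≤⟨ +-mono-≤ (*-monoʳ-≤ p (*-mono-≤ E≤a E≤a)) (*-monoʳ-≤ q (*-monoˡ-≤ a E≤a)) ⟩
    p * (a * a) + q * (a * a)      ≡⟨ *-distribʳ-+ (a * a) p q ⟨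
    (p + q) * (a * a)              ∎)))
    where
    open ≤-Reasoning
    E≤a : E ≤ a
    E≤a = <⇒≤ (≰⇒> a≰E)
    a²≢0 : NonZero (a * a)
    a²≢0 = m*n≢0 a a {{>-nonZero (≤-trans z<s (≰⇒> a≰E))}} {{>-nonZero (≤-trans z<s (≰⇒> a≰E))}}


-- Degrees

∑-tabulate : ∀ n (f : Fin n → ℕ) → ListAction.sum (List.tabulate f) ≡ ∑[ i < n ] f i
∑-tabulate zero    f = refl
∑-tabulate (suc n) f = cong (f zero +_) (∑-tabulate n (f ∘ suc))

∑-allFin : ∀ n (f : Fin n → ℕ) → ListAction.sum (List.map f (List.allFin n)) ≡ ∑[ i < n ] f i
∑-allFin n f = trans (cong ListAction.sum (map-tabulate id f)) (∑-tabulate n f)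

module _ {m : ℕ} (G : Graph m) where

  degree : Fin m → ℕ
  degree u = count (adj G u)

  degreeSum : ℕ
  degreeSum = ∑[ u < m ] degree u

  handshake : degreeSum ≡ edgeCount G + edgeCount G
  handshake = begin
    ∑[ i < m ] ∑[ j < m ] ⟦ adj G i j ⟧                         ≡⟨ sum-cong-≗ {m} (λ i → trans (sum-cong-≗ {m} (split i))
                                                                      (∑-distrib-+ (λ j → ⟦ i ≺ j ∧ adj G i j ⟧) (λ j → ⟦ j ≺ i ∧ adj G i j ⟧))) ⟩
    ∑[ i < m ] (∑[ j < m ] ⟦ i ≺ j ∧ adj G i j ⟧ + ∑[ j < m ] ⟦ j ≺ i ∧ adj G i j ⟧)
                                                                ≡⟨ ∑-distrib-+ (λ i → ∑[ j < m ] ⟦ i ≺ j ∧ adj G i j ⟧) (λ i → ∑[ j < m ] ⟦ j ≺ i ∧ adj G i j ⟧) ⟩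
    e + ∑[ i < m ] ∑[ j < m ] ⟦ j ≺ i ∧ adj G i j ⟧              ≡⟨ cong (e +_) (∑-comm (λ i j → ⟦ j ≺ i ∧ adj G i j ⟧)) ⟩
    e + ∑[ j < m ] ∑[ i < m ] ⟦ j ≺ i ∧ adj G i j ⟧              ≡⟨ cong (e +_) (sum-cong-≗ {m} λ j → sum-cong-≗ {m} λ i →
                                                                      cong (λ b → ⟦ j ≺ i ∧ b ⟧) (Graph.sym G i j)) ⟩
    e + e                                                       ≡⟨ cong₂ _+_ edgeCount≡e edgeCount≡e ⟨
    edgeCount G + edgeCount G                                   ∎
    where
    open ≡-Reasoning
    _≺_ : Fin m → Fin m → Bool
    i ≺ j = toℕ i <ᵇ toℕ j
    e : ℕ
    e = ∑[ i < m ] ∑[ j < m ] ⟦ i ≺ j ∧ adj G i j ⟧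
    edgeCount≡e : edgeCount G ≡ e
    edgeCount≡e = trans (∑-allFin m _) (sum-cong-≗ {m} λ i → trans (∑-allFin m _) (sum-cong-≗ {m} λ j → if≡⟦⟧ _))
      where
      if≡⟦⟧ : ∀ b → (if b then 1 else 0) ≡ ⟦ b ⟧
      if≡⟦⟧ true  = refl
      if≡⟦⟧ false = refl
    split : ∀ i j → ⟦ adj G i j ⟧ ≡ ⟦ i ≺ j ∧ adj G i j ⟧ + ⟦ j ≺ i ∧ adj G i j ⟧
    split i j with adj G i j in i~j
    ... | false = sym (cong₂ _+_ (cong ⟦_⟧ (∧-zeroʳ (i ≺ j))) (cong ⟦_⟧ (∧-zeroʳ (j ≺ i))))
    ... | true with i ≺ j | <ᵇ-reflects-< (toℕ i) (toℕ j) | j ≺ i | <ᵇ-reflects-< (toℕ j) (toℕ i)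
    ...   | true  | _      | false | _      = refl
    ...   | false | _      | true  | _      = refl
    ...   | true  | ofʸ i<j | true  | ofʸ j<i = ⊥-elim (<-asym i<j j<i)
    ...   | false | ofⁿ i≮j | false | ofⁿ j≮i =
      ⊥-elim (true≢false (subst (λ k → adj G i k ≡ true) (toℕ-injective (≤-antisym (≮⇒≥ i≮j) (≮⇒≥ j≮i))) i~j)
                         (Graph.irrefl G i))

  dominating-bound : (S : Fin m → Bool) → (∀ v → S v ≡ false → ∃ λ u → S u ≡ true × adj G u v ≡ true) →
                     m ≤ count S + ∑[ u < m ] (⟦ S u ⟧ * degree u)
  dominating-bound S dominating = begin
    m                                                       ≡⟨ trans (∑-const m 1) (*-identityʳ m) ⟨
    ∑[ v < m ] 1                                            ≤⟨ ∑-mono-≤ covered ⟩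
    ∑[ v < m ] (⟦ S v ⟧ + ∑[ u < m ] (⟦ S u ⟧ * ⟦ adj G u v ⟧))
                                                            ≡⟨ ∑-distrib-+ (λ v → ⟦ S v ⟧) (λ v → ∑[ u < m ] (⟦ S u ⟧ * ⟦ adj G u v ⟧)) ⟩
    count S + ∑[ v < m ] ∑[ u < m ] (⟦ S u ⟧ * ⟦ adj G u v ⟧) ≡⟨ cong (count S +_) (∑-comm (λ v u → ⟦ S u ⟧ * ⟦ adj G u v ⟧)) ⟩
    count S + ∑[ u < m ] ∑[ v < m ] (⟦ S u ⟧ * ⟦ adj G u v ⟧) ≡⟨ cong (count S +_) (sum-cong-≗ {m} λ u → *-distribˡ-sum ⟦ S u ⟧ (λ v → ⟦ adj G u v ⟧)) ⟨
    count S + ∑[ u < m ] (⟦ S u ⟧ * degree u)               ∎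
    where
    open ≤-Reasoning
    covered : ∀ v → 1 ≤ ⟦ S v ⟧ + ∑[ u < m ] (⟦ S u ⟧ * ⟦ adj G u v ⟧)
    covered v with S v in Sv
    ... | true  = s≤s z≤n
    ... | false = let u , Su , u~v = dominating v Sv in
      subst (_≤ ∑[ u < m ] (⟦ S u ⟧ * ⟦ adj G u v ⟧)) (cong₂ (λ a b → ⟦ a ⟧ * ⟦ b ⟧) Su u~v)
            (term≤∑ (λ u → ⟦ S u ⟧ * ⟦ adj G u v ⟧) u)


-- Triangle-free graphs with a family of maximal independent triples

module TripleSystem {m : ℕ} (G : Graph m) (triangle-free : TriangleFree G)
  {s : ℕ} (T : Fin s → Fin m → Bool)
  (size        : ∀ k → count (T k) ≡ 3)
  (independent : ∀ k u v → T k u ≡ true → T k v ≡ true → adj G u v ≡ false)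
  (dominating  : ∀ k v → T k v ≡ false → ∃ λ u → T k u ≡ true × adj G u v ≡ true)
  (distinct    : ∀ k k′ → (∀ v → T k v ≡ T k′ v) → k ≡ k′)
  where

  E M : ℕ
  E = degreeSum G
  M = m ∸ 3

  only-members : ∀ k {x y z} → T k x ≡ true → T k y ≡ true → T k z ≡ true → x ≢ y → x ≢ z → y ≢ z →
                 ∀ w → T k w ≡ true → w ≡ x ⊎ w ≡ y ⊎ w ≡ z
  only-members k = count≡3⇒only (T k) (size k)

  ⊆⇒≡ : ∀ {k k′} → (∀ v → T k v ≡ true → T k′ v ≡ true) → k ≡ k′
  ⊆⇒≡ {k} {k′} k⊆k′ = distinct k k′ same
    where
    common : ∀ v → ⟦ T k′ v ∧ T k v ⟧ ≡ ⟦ T k v ⟧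
    common v with T k v in kv
    ... | true  = cong ⟦_⟧ (trans (∧-identityʳ (T k′ v)) (k⊆k′ v kv))
    ... | false = cong ⟦_⟧ (∧-zeroʳ (T k′ v))
    extra : ℕ
    extra = count (λ v → T k′ v ∧ not (T k v))
    no-extra : extra ≡ 0
    no-extra = +-cancelˡ-≡ 3 extra 0 (begin
      3 + extra                                       ≡⟨ cong (_+ extra) (trans (sum-cong-≗ {m} common) (size k)) ⟨
      count (λ v → T k′ v ∧ T k v) + extra            ≡⟨ count-split (T k′) (T k) ⟨
      count (T k′)                                    ≡⟨ size k′ ⟩
      3                                               ∎)
      where open ≡-Reasoning
    same : ∀ v → T k v ≡ T k′ v
    same v with T k v in kv | T k′ v in k′v
    ... | true  | b     = trans (sym (k⊆k′ v kv)) k′v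
    ... | false | false = refl
    ... | false | true  = ⊥-elim (true≢false (cong₂ (λ a b → a ∧ not b) k′v kv) (count≡0⇒false _ no-extra v))

  third-dominates : ∀ k {x y w v} → T k x ≡ true → T k y ≡ true → T k w ≡ true → x ≢ y → x ≢ w → y ≢ w →
                    T k v ≡ false → adj G x v ≡ false → adj G y v ≡ false → adj G w v ≡ true
  third-dominates k Tx Ty Tw x≢y x≢w y≢w v∉ x≁v y≁v with dominating k _ v∉
  ... | u , Tu , u~v with only-members k Tx Ty Tw x≢y x≢w y≢w u Tu
  ...   | inj₁ refl        = ⊥-elim (true≢false u~v x≁v)
  ...   | inj₂ (inj₁ refl) = ⊥-elim (true≢false u~v y≁v)
  ...   | inj₂ (inj₂ refl) = u~v

  sharing-three⇒≡ : ∀ {k k′ x y w} → T k x ≡ true → T k y ≡ true → T k w ≡ true → x ≢ y → x ≢ w → y ≢ w →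
                    T k′ x ≡ true → T k′ y ≡ true → T k′ w ≡ true → k ≡ k′
  sharing-three⇒≡ {k} Tx Ty Tw x≢y x≢w y≢w T′x T′y T′w = ⊆⇒≡ λ v Tv →
    case only-members k Tx Ty Tw x≢y x≢w y≢w v Tv of λ where
      (inj₁ refl)        → T′x
      (inj₂ (inj₁ refl)) → T′y
      (inj₂ (inj₂ refl)) → T′w

  sharing-pair⇒≡ : ∀ {k k′ x y w w′} → T k x ≡ true → T k y ≡ true → T k w ≡ true →
                   T k′ x ≡ true → T k′ y ≡ true → T k′ w′ ≡ true →
                   x ≢ y → x ≢ w → y ≢ w → x ≢ w′ → y ≢ w′ → adj G w′ w ≡ false → k ≡ k′
  sharing-pair⇒≡ {k} {k′} {x} {y} {w} Tx Ty Tw T′x T′y T′w′ x≢y x≢w y≢w x≢w′ y≢w′ w′≁w with T k′ w in T′w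
  ... | true  = sharing-three⇒≡ Tx Ty Tw x≢y x≢w y≢w T′x T′y T′w
  ... | false = ⊥-elim (true≢false (third-dominates k′ T′x T′y T′w′ x≢y x≢w′ y≢w′ T′w
                                      (independent k x w Tx Tw) (independent k y w Ty Tw)) w′≁w)

  co-frequency : Fin m → Fin m → ℕ
  co-frequency u v = count (λ k → T k u ∧ T k v)

  co-frequency≤2 : ∀ {u v} → u ≢ v → co-frequency u v ≤ 2
  co-frequency≤2 {u} {v} u≢v = ≮⇒≥ λ 2<cof →
    let k₁ , k₂ , k₃ , ∈₁ , ∈₂ , ∈₃ , k₁≢k₂ , k₁≢k₃ , k₂≢k₃ = count≥3⇒members _ 2<cof
        w₁ , T₁w₁ , w₁≢u , w₁≢v = count≡3⇒third (T k₁) (size k₁) (∧-true⁻ ∈₁ .proj₁) (∧-true⁻ ∈₁ .proj₂) u≢v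
        w₂ , T₂w₂ , w₂≢u , w₂≢v = count≡3⇒third (T k₂) (size k₂) (∧-true⁻ ∈₂ .proj₁) (∧-true⁻ ∈₂ .proj₂) u≢v
        w₃ , T₃w₃ , w₃≢u , w₃≢v = count≡3⇒third (T k₃) (size k₃) (∧-true⁻ ∈₃ .proj₁) (∧-true⁻ ∈₃ .proj₂) u≢v
    in triangle-free w₁ w₂ w₃ (third-adjacent ∈₁ ∈₂ k₁≢k₂ T₁w₁ w₁≢u w₁≢v T₂w₂ w₂≢u w₂≢v)
                              (third-adjacent ∈₂ ∈₃ k₂≢k₃ T₂w₂ w₂≢u w₂≢v T₃w₃ w₃≢u w₃≢v)
                              (third-adjacent ∈₁ ∈₃ k₁≢k₃ T₁w₁ w₁≢u w₁≢v T₃w₃ w₃≢u w₃≢v)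
    where
    third-adjacent : ∀ {k k′ w w′} → T k u ∧ T k v ≡ true → T k′ u ∧ T k′ v ≡ true → k ≢ k′ →
                     T k w ≡ true → w ≢ u → w ≢ v → T k′ w′ ≡ true → w′ ≢ u → w′ ≢ v → adj G w w′ ≡ true
    third-adjacent {k} {k′} {w} {w′} ∈k ∈k′ k≢k′ Tw w≢u w≢v T′w′ w′≢u w′≢v with T k w′ in Tw′
    ... | true  = ⊥-elim (k≢k′ (sharing-three⇒≡ (∧-true⁻ ∈k .proj₁) (∧-true⁻ ∈k .proj₂) Tw′ u≢v (w′≢u ∘ sym) (w′≢v ∘ sym)
                                                (∧-true⁻ ∈k′ .proj₁) (∧-true⁻ ∈k′ .proj₂) T′w′))
    ... | false = third-dominates k (∧-true⁻ ∈k .proj₁) (∧-true⁻ ∈k .proj₂) Tw u≢v (w≢u ∘ sym) (w≢v ∘ sym) Tw′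
                    (independent k′ u w′ (∧-true⁻ ∈k′ .proj₁) T′w′) (independent k′ v w′ (∧-true⁻ ∈k′ .proj₂) T′w′)

  co-frequency-adjacent : ∀ {u v} → adj G u v ≡ true → co-frequency u v ≡ 0
  co-frequency-adjacent {u} {v} u~v = ∑-zero {s} λ k → cong ⟦_⟧ (none k)
    where
    none : ∀ k → T k u ∧ T k v ≡ false
    none k with T k u in Tu | T k v in Tv
    ... | true  | true  = ⊥-elim (true≢false u~v (independent k u v Tu Tv))
    ... | true  | false = refl
    ... | false | _     = refl

  co-frequency-product≤4 : ∀ {u w} c → adj G u w ≡ true → co-frequency u c * co-frequency w c ≤ 4
  co-frequency-product≤4 {u} {w} c u~w with u ≟ c | w ≟ c
  ... | yes refl | _        = subst (λ n → co-frequency u u * n ≤ 4) (sym (co-frequency-adjacent (trans (Graph.sym G w u) u~w)))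
                                    (≤-trans (≤-reflexive (*-zeroʳ (co-frequency u u))) z≤n)
  ... | no _     | yes refl = subst (λ n → n * co-frequency w w ≤ 4) (sym (co-frequency-adjacent u~w)) z≤n
  ... | no u≢c   | no w≢c   = *-mono-≤ (co-frequency≤2 u≢c) (co-frequency≤2 w≢c)

  triple-degree-sum : Fin s → ℕ
  triple-degree-sum k = ∑[ u < m ] (⟦ T k u ⟧ * degree G u)

  M≤triple-degree-sum : ∀ k → M ≤ triple-degree-sum k
  M≤triple-degree-sum k = m≤n+o⇒m∸n≤o m 3 (subst (λ c → m ≤ c + triple-degree-sum k) (size k)
                                        (dominating-bound G (T k) (dominating k)))

  M≤E : Fin s → M ≤ E
  M≤E k = ≤-trans (M≤triple-degree-sum k) (∑-mono-≤ λ u → ⟦⟧*-≤ (T k u) (degree G u))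

  high : Fin m → Bool
  high u = M ≤ᵇ 3 * degree G u

  h : ℕ
  h = count high

  h*M≤3E : h * M ≤ 3 * E
  h*M≤3E = begin
    h * M                                ≡⟨ *-distribʳ-sum M (⟦_⟧ ∘ high) ⟩
    ∑[ u < m ] (⟦ high u ⟧ * M)          ≤⟨ ∑-mono-≤ bound ⟩
    ∑[ u < m ] (3 * degree G u)          ≡⟨ *-distribˡ-sum 3 (degree G) ⟨
    3 * E                                ∎
    where
    open ≤-Reasoning
    bound : ∀ u → ⟦ high u ⟧ * M ≤ 3 * degree G u
    bound u with high u in high-u
    ... | false = z≤n
    ... | true  = ≤-trans (≤-reflexive (+-identityʳ M)) (≤ᵇ≡true⇒≤ high-u)

  high-member : ∀ k → ∃ λ u → T k u ≡ true × high u ≡ true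
  high-member k =
    let u , Tu , M≤3d = average-attained (T k) (degree G) (subst (0 <_) (sym (size k)) z<s) (M≤triple-degree-sum k)
    in u , Tu , ≤⇒≤ᵇ≡true (subst (λ c → M ≤ c * degree G u) (size k) M≤3d)

  through : Fin m → (Fin s → Bool) → Fin s → Bool
  through z X k = T k z ∧ X k

  count≤via-high : ∀ X → count X ≤ ∑[ z < m ] (⟦ high z ⟧ * count (through z X))
  count≤via-high X = count≤∑witnesses {Q = high} (λ k z → through z X k)
                       (λ k Xk → let z , Tz , high-z = high-member k in z , high-z , ∧-true⁺ Tz Xk)

  ∑-through : ∀ X → ∑[ z < m ] count (through z X) ≡ 3 * count X
  ∑-through X = begin
    ∑[ z < m ] ∑[ k < s ] ⟦ T k z ∧ X k ⟧        ≡⟨ ∑-comm (λ z k → ⟦ T k z ∧ X k ⟧) ⟩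
    ∑[ k < s ] ∑[ z < m ] ⟦ T k z ∧ X k ⟧        ≡⟨ sum-cong-≗ {s} (λ k → sum-cong-≗ {m} λ z → ⟦∧⟧ (T k z) (X k)) ⟩
    ∑[ k < s ] ∑[ z < m ] (⟦ T k z ⟧ * ⟦ X k ⟧)  ≡⟨ sum-cong-≗ {s} (λ k → *-distribʳ-sum ⟦ X k ⟧ (λ z → ⟦ T k z ⟧)) ⟨
    ∑[ k < s ] (count (T k) * ⟦ X k ⟧)           ≡⟨ sum-cong-≗ {s} (λ k → cong (_* ⟦ X k ⟧) (size k)) ⟩
    ∑[ k < s ] (3 * ⟦ X k ⟧)                     ≡⟨ *-distribˡ-sum 3 (⟦_⟧ ∘ X) ⟨
    3 * count X                                  ∎
    where open ≡-Reasoning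

  edge-between : ∀ {k k′} → k ≢ k′ → ∃ λ u → ∃ λ w → T k u ≡ true × T k′ w ≡ true × adj G u w ≡ true
  edge-between {k} {k′} k≢k′ with any? (λ v → T k v Bool.≟ not (T k′ v))
  ... | no agree = ⊥-elim (k≢k′ (distinct k k′ λ v → not-opposite (λ e → agree (v , e))))
    where
    not-opposite : ∀ {a b} → a ≢ not b → a ≡ b
    not-opposite {false} {false} _ = refl
    not-opposite {true}  {true}  _ = refl
    not-opposite {false} {true}  ¬opp = ⊥-elim (¬opp refl)
    not-opposite {true}  {false} ¬opp = ⊥-elim (¬opp refl)
  ... | yes (v , opposite) with T k v in Tv | T k′ v in T′v
  ...   | true  | false = let w , T′w , w~v = dominating k′ v T′v in v , w , Tv , T′w , trans (Graph.sym G v w) w~v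
  ...   | false | true  = let u , Tu , u~v = dominating k v Tv in u , v , Tu , T′v , u~v

  frequency : Fin m → ℕ
  frequency c = count (λ k → T k c)

  frequency-bound : ∀ c → frequency c * (frequency c ∸ 1) ≤ 4 * E
  frequency-bound c = begin
    frequency c * (frequency c ∸ 1)                                     ≡⟨ ∑-ordered-pairs Tc ⟨
    ∑[ k < s ] (⟦ Tc k ⟧ * count (Tc ∖ k))                              ≡⟨ sum-cong-≗ {s} (λ k → *-distribˡ-sum ⟦ Tc k ⟧ (λ k′ → ⟦ (Tc ∖ k) k′ ⟧)) ⟩
    ∑[ k < s ] ∑[ k′ < s ] (⟦ Tc k ⟧ * ⟦ (Tc ∖ k) k′ ⟧)                  ≤⟨ ∑-mono-≤ (λ k → ∑-mono-≤ (edge k)) ⟩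
    ∑[ k < s ] ∑[ k′ < s ] ∑[ u < m ] ∑[ w < m ] F k k′ u w             ≡⟨ ∑-comm₄ F ⟩
    ∑[ u < m ] ∑[ w < m ] ∑[ k < s ] ∑[ k′ < s ] F k k′ u w             ≡⟨ sum-cong-≗ {m} (λ u → sum-cong-≗ {m} λ w →
                                                                         ∑∑-scaled-product ⟦ adj G u w ⟧ (λ k → ⟦ T k u ∧ T k c ⟧) (λ k → ⟦ T k w ∧ T k c ⟧)) ⟩
    ∑[ u < m ] ∑[ w < m ] (⟦ adj G u w ⟧ * (co-frequency u c * co-frequency w c))
                                                                        ≤⟨ ∑-mono-≤ (λ u → ∑-mono-≤ (≤4 u)) ⟩
    ∑[ u < m ] ∑[ w < m ] (4 * ⟦ adj G u w ⟧)                           ≡⟨ sum-cong-≗ {m} (λ u → *-distribˡ-sum 4 (λ w → ⟦ adj G u w ⟧)) ⟨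
    ∑[ u < m ] (4 * degree G u)                                         ≡⟨ *-distribˡ-sum 4 (degree G) ⟨
    4 * E                                                               ∎
    where
    open ≤-Reasoning
    Tc : Fin s → Bool
    Tc k = T k c
    F : Fin s → Fin s → Fin m → Fin m → ℕ
    F k k′ u w = ⟦ adj G u w ⟧ * (⟦ T k u ∧ T k c ⟧ * ⟦ T k′ w ∧ T k′ c ⟧)
    edge : ∀ k k′ → ⟦ Tc k ⟧ * ⟦ (Tc ∖ k) k′ ⟧ ≤ ∑[ u < m ] ∑[ w < m ] F k k′ u w
    edge k k′ = subst (_≤ ∑[ u < m ] ∑[ w < m ] F k k′ u w) (⟦∧⟧ (Tc k) ((Tc ∖ k) k′)) (⟦⟧≤ (Tc k ∧ (Tc ∖ k) k′) λ both →
      let Tkc , k′∈ = ∧-true⁻ both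
          u , w , Tu , T′w , u~w = edge-between (∖-≢ Tc k′∈ ∘ sym)
          F≡1 = cong₂ _*_ (cong ⟦_⟧ u~w) (cong₂ (λ a b → ⟦ a ⟧ * ⟦ b ⟧) (∧-true⁺ Tu Tkc) (∧-true⁺ T′w (∖-⊆ Tc k′∈)))
      in ≤-trans (≤-reflexive (sym F≡1))
                 (≤-trans (term≤∑ (F k k′ u) w) (term≤∑ (λ u → ∑[ w < m ] F k k′ u w) u)))
    ≤4 : ∀ u w → ⟦ adj G u w ⟧ * (co-frequency u c * co-frequency w c) ≤ 4 * ⟦ adj G u w ⟧
    ≤4 u w with adj G u w in u~w
    ... | false = z≤n
    ... | true  = ≤-trans (≤-reflexive (+-identityʳ _)) (co-frequency-product≤4 c u~w)

  triples≤2m² : s ≤ m * (m * 2)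
  triples≤2m² = begin
    s                                                    ≡⟨ trans (∑-const s 1) (*-identityʳ s) ⟨
    ∑[ k < s ] 1                                         ≤⟨ ∑-mono-≤ two-members ⟩
    ∑[ k < s ] ∑[ u < m ] ∑[ v < m ] ⟦ pair k u v ⟧      ≡⟨ ∑-comm (λ k u → ∑[ v < m ] ⟦ pair k u v ⟧) ⟩
    ∑[ u < m ] ∑[ k < s ] ∑[ v < m ] ⟦ pair k u v ⟧      ≡⟨ sum-cong-≗ {m} (λ u → ∑-comm (λ k v → ⟦ pair k u v ⟧)) ⟩
    ∑[ u < m ] ∑[ v < m ] count (λ k → pair k u v)       ≤⟨ ∑-mono-≤ (λ u → ∑-mono-≤ (at-most-two u)) ⟩
    ∑[ u < m ] ∑[ v < m ] 2                              ≡⟨ trans (sum-cong-≗ {m} λ _ → ∑-const m 2) (∑-const m (m * 2)) ⟩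
    m * (m * 2)                                          ∎
    where
    open ≤-Reasoning
    pair : Fin s → Fin m → Fin m → Bool
    pair k u v = T k u ∧ (T k ∖ u) v
    two-members : ∀ k → 1 ≤ ∑[ u < m ] ∑[ v < m ] ⟦ pair k u v ⟧
    two-members k =
      let u , v , _ , Tu , Tv , _ , u≢v , _ = count≥3⇒members (T k) (≤-reflexive (sym (size k)))
      in ≤-trans (≤-reflexive (cong ⟦_⟧ (sym (∧-true⁺ Tu (∖-intro (T k) Tv (u≢v ∘ sym))))))
                 (≤-trans (term≤∑ (λ v → ⟦ pair k u v ⟧) v) (term≤∑ (λ u → ∑[ v < m ] ⟦ pair k u v ⟧) u))
    at-most-two : ∀ u v → count (λ k → pair k u v) ≤ 2
    at-most-two u v = case v ≟ u of λ where
      (yes refl) → ≤-trans (count-mono {Q = λ _ → false} λ k pair≡true →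
                             ⊥-elim (∖-≢ (T k) {u} (∧-true⁻ {T k u} pair≡true .proj₂) refl))
                           (≤-trans (≤-reflexive (∑-zero {s} λ _ → refl)) z≤n)
      (no v≢u)   → ≤-trans (count-mono λ k pair≡true →
                             let Tu , v∈ = ∧-true⁻ pair≡true in ∧-true⁺ Tu (∖-⊆ (T k) v∈))
                           (co-frequency≤2 (v≢u ∘ sym))

  outside-dominator : ∀ {C : Fin m → Bool} → (∀ {u v} → C u ≡ true → C v ≡ true → adj G u v ≡ false) →
                      ∀ k {v} → C v ≡ true → T k v ≡ false → ∃ λ u → T k u ≡ true × C u ≡ false × adj G u v ≡ true
  outside-dominator {C} C-independent k {v} Cv v∉ with dominating k v v∉
  ... | u , Tu , u~v with C u in Cu
  ...   | true  = ⊥-elim (true≢false u~v (C-independent Cu Cv))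
  ...   | false = u , Tu , Cu , u~v

  module ThreeParts (apex : Fin m) (colour : Fin m → Fin 3)
    (proper : ∀ {u v} → u ≢ apex → v ≢ apex → colour u ≡ colour v → adj G u v ≡ false) where

    part : Fin 3 → Fin m → Bool
    part i v = not (does (v ≟ apex)) ∧ does (colour v ≟ i)

    part⁻ : ∀ {i v} → part i v ≡ true → v ≢ apex × colour v ≡ i
    part⁻ {i} {v} v∈ with v ≟ apex | colour v ≟ i
    ... | no v≢apex | yes colour≡i = v≢apex , colour≡i

    part⁺ : ∀ {v} → v ≢ apex → part (colour v) v ≡ true
    part⁺ {v} v≢apex with v ≟ apex | colour v ≟ colour v
    ... | yes v≡apex | _         = ⊥-elim (v≢apex v≡apex)
    ... | no _       | yes _     = refl
    ... | no _       | no ¬refl = ⊥-elim (¬refl refl)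

    part-independent : ∀ {i u v} → part i u ≡ true → part i v ≡ true → adj G u v ≡ false
    part-independent u∈ v∈ = let u≢apex , cu = part⁻ u∈ ; v≢apex , cv = part⁻ v∈ in proper u≢apex v≢apex (trans cu (sym cv))

    parts-disjoint : ∀ {i j u v} → part i u ≡ true → part j v ≡ true → i ≢ j → u ≢ v
    parts-disjoint u∈ v∈ i≢j refl = i≢j (trans (sym (part⁻ u∈ .proj₂)) (part⁻ v∈ .proj₂))

    count-by-parts : ∀ (P : Fin m → Bool) → count P ≡ ⟦ P apex ⟧ + ∑[ i < 3 ] count (λ v → P v ∧ part i v)
    count-by-parts P = begin
      count P                                                          ≡⟨ sum-cong-≗ {m} split ⟩
      ∑[ v < m ] (⟦ P v ∧ does (v ≟ apex) ⟧ + ∑[ i < 3 ] ⟦ P v ∧ part i v ⟧)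
                                                                       ≡⟨ ∑-distrib-+ (λ v → ⟦ P v ∧ does (v ≟ apex) ⟧) (λ v → ∑[ i < 3 ] ⟦ P v ∧ part i v ⟧) ⟩
      count (λ v → P v ∧ does (v ≟ apex)) + ∑[ v < m ] ∑[ i < 3 ] ⟦ P v ∧ part i v ⟧
                                                                       ≡⟨ cong₂ _+_ (count-at P apex) (∑-comm (λ v i → ⟦ P v ∧ part i v ⟧)) ⟩
      ⟦ P apex ⟧ + ∑[ i < 3 ] count (λ v → P v ∧ part i v)             ∎
      where
      open ≡-Reasoning
      split : ∀ v → ⟦ P v ⟧ ≡ ⟦ P v ∧ does (v ≟ apex) ⟧ + ∑[ i < 3 ] ⟦ P v ∧ part i v ⟧
      split v with P v | v ≟ apex | colour v
      ... | false | _     | _    = refl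
      ... | true  | yes _ | _    = refl
      ... | true  | no _  | zero = refl
      ... | true  | no _  | suc zero = refl
      ... | true  | no _  | suc (suc zero) = refl

    share : Fin 3 → Fin s → ℕ
    share i k = count (λ v → T k v ∧ part i v)

    pairIn allIn : Fin 3 → Fin s → Bool
    pairIn i k = share i k ≡ᵇ 2
    allIn  i k = share i k ≡ᵇ 3

    rainbow : Fin s → Bool
    rainbow k = (share zero k ≡ᵇ 1) ∧ (share (suc zero) k ≡ᵇ 1) ∧ (share (suc (suc zero)) k ≡ᵇ 1)

    triple-type : ∀ k → 1 ≤ ⟦ T k apex ⟧ + ∑[ i < 3 ] ⟦ pairIn i k ⟧ + ∑[ i < 3 ] ⟦ allIn i k ⟧ + ⟦ rainbow k ⟧
    triple-type k with T k apex in Tapex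
    ... | true  = s≤s z≤n
    ... | false = shares-type a b c (trans (sym (cong (λ x → a + (b + x)) (+-identityʳ c))) ∑shares≡3)
      where
      a = share zero k
      b = share (suc zero) k
      c = share (suc (suc zero)) k
      ∑shares≡3 : ∑[ i < 3 ] share i k ≡ 3
      ∑shares≡3 = subst (λ x → ⟦ x ⟧ + ∑[ i < 3 ] share i k ≡ 3) Tapex (trans (sym (count-by-parts (T k))) (size k))
      shares-type : ∀ a b c → a + (b + c) ≡ 3 →
        1 ≤ ⟦ a ≡ᵇ 2 ⟧ + (⟦ b ≡ᵇ 2 ⟧ + (⟦ c ≡ᵇ 2 ⟧ + 0)) + (⟦ a ≡ᵇ 3 ⟧ + (⟦ b ≡ᵇ 3 ⟧ + (⟦ c ≡ᵇ 3 ⟧ + 0)))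
            + ⟦ (a ≡ᵇ 1) ∧ (b ≡ᵇ 1) ∧ (c ≡ᵇ 1) ⟧
      shares-type 0 0 .3 refl = s≤s z≤n
      shares-type 0 1 .2 refl = s≤s z≤n
      shares-type 0 2 .1 refl = s≤s z≤n
      shares-type 0 3 .0 refl = s≤s z≤n
      shares-type 1 0 .2 refl = s≤s z≤n
      shares-type 1 1 .1 refl = s≤s z≤n
      shares-type 1 2 .0 refl = s≤s z≤n
      shares-type 2 0 .1 refl = s≤s z≤n
      shares-type 2 1 .0 refl = s≤s z≤n
      shares-type 3 0 .0 refl = s≤s z≤n
      shares-type 0 (suc (suc (suc (suc _)))) _ ()
      shares-type 1 (suc (suc (suc _))) _ ()
      shares-type 2 (suc (suc _)) _ ()
      shares-type 3 (suc _) _ ()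
      shares-type (suc (suc (suc (suc _)))) _ _ ()

    s≤by-type : s ≤ frequency apex + ∑[ i < 3 ] count (pairIn i) + ∑[ i < 3 ] count (allIn i) + count rainbow
    s≤by-type = begin
      s                                                        ≡⟨ trans (∑-const s 1) (*-identityʳ s) ⟨
      ∑[ k < s ] 1                                             ≤⟨ ∑-mono-≤ triple-type ⟩
      ∑[ k < s ] (A k + B k + C k + D k)                       ≡⟨ ∑-distrib-+ (λ k → A k + B k + C k) D ⟩
      ∑[ k < s ] (A k + B k + C k) + count rainbow             ≡⟨ cong (_+ count rainbow) (∑-distrib-+ (λ k → A k + B k) C) ⟩
      ∑[ k < s ] (A k + B k) + sum C + count rainbow           ≡⟨ cong (λ x → x + sum C + count rainbow) (∑-distrib-+ A B) ⟩
      frequency apex + sum B + sum C + count rainbow           ≡⟨ cong₂ (λ x y → frequency apex + x + y + count rainbow)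
                                                                    (∑-comm (λ k i → ⟦ pairIn i k ⟧)) (∑-comm (λ k i → ⟦ allIn i k ⟧)) ⟩
      frequency apex + ∑[ i < 3 ] count (pairIn i) + ∑[ i < 3 ] count (allIn i) + count rainbow ∎
      where
      open ≤-Reasoning
      A B C D : Fin s → ℕ
      A k = ⟦ T k apex ⟧
      B k = ∑[ i < 3 ] ⟦ pairIn i k ⟧
      C k = ∑[ i < 3 ] ⟦ allIn i k ⟧
      D k = ⟦ rainbow k ⟧

    part-size : Fin 3 → ℕ
    part-size i = count (part i)

    outsiders : Fin 3 → Fin s → Fin m → Bool
    outsiders i k v = T k v ∧ not (part i v)

    share+outsiders : ∀ i k → share i k + count (outsiders i k) ≡ 3
    share+outsiders i k = trans (sym (count-split (T k) (part i))) (size k)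

    module _ {i : Fin 3} where

      pairIn-outsiders : ∀ {k} → pairIn i k ≡ true → count (outsiders i k) ≡ 1
      pairIn-outsiders {k} pair = +-cancelˡ-≡ 2 _ _
        (trans (cong (_+ count (outsiders i k)) (sym (≡ᵇ≡true⇒≡ pair))) (share+outsiders i k))

      pairIn-determined : ∀ {k b} → pairIn i k ≡ true → T k b ≡ true → part i b ≡ false →
                          ∀ {v} → part i v ≡ true → adj G b v ≡ false → T k v ≡ true
      pairIn-determined {k} {b} pair Tb b∉ {v} v∈ b≁v with T k v in Tv
      ... | true  = refl
      ... | false =
        let u , Tu , u∉ , u~v = outside-dominator part-independent k v∈ Tv
            u≡b = count≡1⇒unique (outsiders i k) (pairIn-outsiders pair)
                    (∧-true⁺ Tu (cong not u∉)) (∧-true⁺ Tb (cong not b∉))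
        in ⊥-elim (true≢false (subst (λ x → adj G x v ≡ true) u≡b u~v) b≁v)

      pairIn-unique : ∀ {k k′ b} → pairIn i k ≡ true → pairIn i k′ ≡ true → T k b ≡ true → T k′ b ≡ true →
                      part i b ≡ false → k ≡ k′
      pairIn-unique {k} {k′} {b} pair pair′ Tb T′b b∉ = ⊆⇒≡ member
        where
        member : ∀ v → T k v ≡ true → T k′ v ≡ true
        member v Tv with part i v in v∈
        ... | true  = pairIn-determined pair′ T′b b∉ v∈ (independent k b v Tb Tv)
        ... | false = subst (λ x → T k′ x ≡ true)
                        (count≡1⇒unique (outsiders i k) (pairIn-outsiders pair) (∧-true⁺ Tb (cong not b∉)) (∧-true⁺ Tv (cong not v∈)))
                        T′b

      part-size≤ : ∀ {k b} → pairIn i k ≡ true → T k b ≡ true → part i b ≡ false → part-size i ≤ degree G b + 2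
      part-size≤ {k} {b} pair Tb b∉ = begin
        part-size i                                           ≤⟨ ∑-mono-≤ covered ⟩
        ∑[ v < m ] (⟦ adj G b v ⟧ + ⟦ T k v ∧ part i v ⟧)      ≡⟨ ∑-distrib-+ (λ v → ⟦ adj G b v ⟧) (λ v → ⟦ T k v ∧ part i v ⟧) ⟩
        degree G b + share i k                                ≡⟨ cong (degree G b +_) (≡ᵇ≡true⇒≡ pair) ⟩
        degree G b + 2                                        ∎
        where
        open ≤-Reasoning
        covered : ∀ v → ⟦ part i v ⟧ ≤ ⟦ adj G b v ⟧ + ⟦ T k v ∧ part i v ⟧
        covered v = ⟦⟧≤ (part i v) (one v)
          where
          one : ∀ v → part i v ≡ true → 1 ≤ ⟦ adj G b v ⟧ + ⟦ T k v ∧ part i v ⟧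
          one v v∈ with adj G b v in b~v
          ... | true  = s≤s z≤n
          ... | false = ≤-reflexive (cong ⟦_⟧ (sym (∧-true⁺ (pairIn-determined pair Tb b∉ v∈ b~v) v∈)))

      pairIn-bound₁ : count (pairIn i) * (part-size i ∸ 2) ≤ E
      pairIn-bound₁ = begin
        count (pairIn i) * (part-size i ∸ 2)                   ≤⟨ *-monoˡ-≤ (part-size i ∸ 2) (count≤∑witnesses {Q = small-part} R outsider) ⟩
        ∑[ b < m ] (⟦ small-part b ⟧ * count (λ k → R k b)) * (part-size i ∸ 2)
                                                               ≤⟨ *-monoˡ-≤ (part-size i ∸ 2) (∑-mono-≤ λ b → *-monoʳ-≤ ⟦ small-part b ⟧ (unique-outsider b)) ⟩
        ∑[ b < m ] (⟦ small-part b ⟧ * 1) * (part-size i ∸ 2)  ≡⟨ *-distribʳ-sum (part-size i ∸ 2) (λ b → ⟦ small-part b ⟧ * 1) ⟩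
        ∑[ b < m ] (⟦ small-part b ⟧ * 1 * (part-size i ∸ 2))  ≤⟨ ∑-mono-≤ degree-bound ⟩
        E                                                      ∎
        where
        open ≤-Reasoning
        small-part : Fin m → Bool
        small-part b = part-size i ≤ᵇ degree G b + 2
        R : Fin s → Fin m → Bool
        R k b = pairIn i k ∧ outsiders i k b
        outsider : ∀ k → pairIn i k ≡ true → ∃ λ b → small-part b ≡ true × R k b ≡ true
        outsider k pair =
          let b , b∈ = count-witness (outsiders i k) (subst (0 <_) (sym (pairIn-outsiders pair)) z<s)
              Tb , b∉ = ∧-true⁻ b∈
          in b , ≤⇒≤ᵇ≡true (part-size≤ pair Tb (not≡true⇒≡false b∉)) , ∧-true⁺ pair b∈
        unique-outsider : ∀ b → count (λ k → R k b) ≤ 1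
        unique-outsider b = count-≤1 (λ k → R k b) λ k k′ Rkb Rk′b →
          let pair , b∈ = ∧-true⁻ Rkb ; pair′ , b∈′ = ∧-true⁻ Rk′b in
          pairIn-unique pair pair′ (∧-true⁻ b∈ .proj₁) (∧-true⁻ b∈′ .proj₁) (not≡true⇒≡false (∧-true⁻ b∈ .proj₂))
        degree-bound : ∀ b → ⟦ small-part b ⟧ * 1 * (part-size i ∸ 2) ≤ degree G b
        degree-bound b with small-part b in small
        ... | false = z≤n
        ... | true  = ≤-trans (≤-reflexive (+-identityʳ _))
                              (m≤n+o⇒m∸n≤o (part-size i) 2 (subst (part-size i ≤_) (+-comm (degree G b) 2) (≤ᵇ≡true⇒≤ small)))

      pairIn-through≤ : ∀ z → count (through z (pairIn i)) ≤ 2 * part-size i + 1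
      pairIn-through≤ z with part i z in z∈
      ... | false = ≤-trans (count-≤1 (through z (pairIn i)) λ k k′ zk zk′ →
                               pairIn-unique (∧-true⁻ zk .proj₂) (∧-true⁻ zk′ .proj₂) (∧-true⁻ zk .proj₁) (∧-true⁻ zk′ .proj₁) z∈)
                            (m≤n+m 1 _)
      ... | true  = begin
        count (through z (pairIn i))                                        ≤⟨ count≤∑witnesses {Q = part i ∖ z} (λ k a → T k a ∧ T k z) partner ⟩
        ∑[ a < m ] (⟦ (part i ∖ z) a ⟧ * co-frequency a z)                 ≤⟨ ∑-mono-≤ at-most-two ⟩
        ∑[ a < m ] (⟦ part i a ⟧ * 2)                                       ≡⟨ *-distribʳ-sum 2 (⟦_⟧ ∘ part i) ⟨
        part-size i * 2                                                     ≤⟨ ≤-trans (≤-reflexive (*-comm (part-size i) 2)) (m≤m+n _ 1) ⟩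
        2 * part-size i + 1                                                 ∎
        where
        open ≤-Reasoning
        partner : ∀ k → through z (pairIn i) k ≡ true → ∃ λ a → (part i ∖ z) a ≡ true × T k a ∧ T k z ≡ true
        partner k zk =
          let Tz , pair = ∧-true⁻ zk
              others : count ((λ v → T k v ∧ part i v) ∖ z) ≡ 1
              others = suc-injective (trans (sym (count-∖ (λ v → T k v ∧ part i v) (∧-true⁺ Tz z∈))) (≡ᵇ≡true⇒≡ pair))
              a , a∈ = count-witness _ (subst (0 <_) (sym others) z<s)
              Ta , a∈i = ∧-true⁻ (∖-⊆ (λ v → T k v ∧ part i v) a∈)
          in a , ∖-intro (part i) a∈i (∖-≢ (λ v → T k v ∧ part i v) a∈) , ∧-true⁺ Ta Tz
        at-most-two : ∀ a → ⟦ (part i ∖ z) a ⟧ * co-frequency a z ≤ ⟦ part i a ⟧ * 2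
        at-most-two a with (part i ∖ z) a in a∈
        ... | false = z≤n
        ... | true  = subst (λ b → co-frequency a z + 0 ≤ ⟦ b ⟧ * 2) (sym (∖-⊆ (part i) {z} {a} a∈))
                        (≤-trans (≤-reflexive (+-identityʳ _)) (co-frequency≤2 (∖-≢ (part i) {z} {a} a∈)))

      pairIn-bound₂ : count (pairIn i) ≤ h * (2 * part-size i + 1)
      pairIn-bound₂ = begin
        count (pairIn i)                                                    ≤⟨ count≤via-high (pairIn i) ⟩
        ∑[ z < m ] (⟦ high z ⟧ * count (through z (pairIn i)))              ≤⟨ ∑-mono-≤ (λ z → *-monoʳ-≤ ⟦ high z ⟧ (pairIn-through≤ z)) ⟩
        ∑[ z < m ] (⟦ high z ⟧ * (2 * part-size i + 1))                     ≡⟨ *-distribʳ-sum (2 * part-size i + 1) (⟦_⟧ ∘ high) ⟨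
        h * (2 * part-size i + 1)                                           ∎
        where open ≤-Reasoning

      allIn-no-outsiders : ∀ {k} → allIn i k ≡ true → count (outsiders i k) ≡ 0
      allIn-no-outsiders {k} all =
        +-cancelˡ-≡ 3 _ 0 (trans (cong (_+ count (outsiders i k)) (sym (≡ᵇ≡true⇒≡ all))) (share+outsiders i k))

      allIn⇒≡part : ∀ {k} → allIn i k ≡ true → ∀ v → T k v ≡ part i v
      allIn⇒≡part {k} all v with T k v in Tv | part i v in v∈
      ... | true  | true  = refl
      ... | false | false = refl
      ... | true  | false =
        ⊥-elim (true≢false (∧-true⁺ Tv (cong not v∈)) (count≡0⇒false (outsiders i k) (allIn-no-outsiders all) v))
      ... | false | true  = let u , Tu , u∉ , _ = outside-dominator part-independent k v∈ Tv in
        ⊥-elim (true≢false (∧-true⁺ Tu (cong not u∉)) (count≡0⇒false (outsiders i k) (allIn-no-outsiders all) u))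

      count-allIn≤1 : count (allIn i) ≤ 1
      count-allIn≤1 = count-≤1 (allIn i) λ k k′ all all′ →
        distinct k k′ λ v → trans (allIn⇒≡part all v) (sym (allIn⇒≡part all′ v))

    third-dominates-parts : ∀ {k x y w v i j l} → T k x ≡ true → T k y ≡ true → T k w ≡ true →
                            part i x ≡ true → part j y ≡ true → part l w ≡ true → i ≢ j → i ≢ l → j ≢ l →
                            T k v ≡ false → adj G x v ≡ false → adj G y v ≡ false → adj G w v ≡ true
    third-dominates-parts {k} Tx Ty Tw x∈ y∈ w∈ i≢j i≢l j≢l =
      third-dominates k Tx Ty Tw (parts-disjoint x∈ y∈ i≢j) (parts-disjoint x∈ w∈ i≢l) (parts-disjoint y∈ w∈ j≢l)

    sharing-parts⇒≡ : ∀ {k k′ x y w w′ i j l} → T k x ≡ true → T k y ≡ true → T k w ≡ true →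
                      T k′ x ≡ true → T k′ y ≡ true → T k′ w′ ≡ true →
                      part i x ≡ true → part j y ≡ true → part l w ≡ true → part l w′ ≡ true →
                      i ≢ j → i ≢ l → j ≢ l → k ≡ k′
    sharing-parts⇒≡ Tx Ty Tw T′x T′y T′w′ x∈ y∈ w∈ w′∈ i≢j i≢l j≢l =
      sharing-pair⇒≡ Tx Ty Tw T′x T′y T′w′ (parts-disjoint x∈ y∈ i≢j) (parts-disjoint x∈ w∈ i≢l) (parts-disjoint y∈ w∈ j≢l)
                     (parts-disjoint x∈ w′∈ i≢l) (parts-disjoint y∈ w′∈ j≢l) (part-independent w′∈ w∈)

    next : Fin 3 → Fin 3
    next zero             = suc zero
    next (suc zero)       = suc (suc zero)
    next (suc (suc zero)) = zero

    next-injective : ∀ {i j} → next i ≡ next j → i ≡ j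
    next-injective {zero}             {zero}             _ = refl
    next-injective {suc zero}         {suc zero}         _ = refl
    next-injective {suc (suc zero)}   {suc (suc zero)}   _ = refl
    next-injective {zero}             {suc zero}         ()
    next-injective {zero}             {suc (suc zero)}   ()
    next-injective {suc zero}         {zero}             ()
    next-injective {suc zero}         {suc (suc zero)}   ()
    next-injective {suc (suc zero)}   {zero}             ()
    next-injective {suc (suc zero)}   {suc zero}         ()

    i≢next : ∀ i → i ≢ next i
    i≢next zero             ()
    i≢next (suc zero)       ()
    i≢next (suc (suc zero)) ()

    i≢next² : ∀ i → i ≢ next (next i)
    i≢next² zero             ()
    i≢next² (suc zero)       ()
    i≢next² (suc (suc zero)) ()

    record Rainbow (k : Fin s) : Set where
      field
        vertex      : Fin 3 → Fin m
        vertex-in   : ∀ i → T k (vertex i) ≡ true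
        vertex-part : ∀ i → part i (vertex i) ≡ true
        only        : ∀ {i v} → T k v ≡ true → part i v ≡ true → v ≡ vertex i
        avoids-apex : T k apex ≡ false

    rainbow⇒Rainbow : ∀ {k} → rainbow k ≡ true → Rainbow k
    rainbow⇒Rainbow {k} rainbow-k = record
      { vertex      = λ i → member i .proj₁
      ; vertex-in   = λ i → ∧-true⁻ {T k (member i .proj₁)} (member i .proj₂) .proj₁
      ; vertex-part = λ i → ∧-true⁻ {T k (member i .proj₁)} (member i .proj₂) .proj₂
      ; only        = λ {i} Tv v∈ → count≡1⇒unique (λ v → T k v ∧ part i v) (share≡1 i) (∧-true⁺ Tv v∈) (member i .proj₂)
      ; avoids-apex = avoids-apex
      }
      where
      share≡1 : ∀ i → share i k ≡ 1
      share≡1 zero             = ≡ᵇ≡true⇒≡ (∧-true⁻ {share zero k ≡ᵇ 1} rainbow-k .proj₁)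
      share≡1 (suc zero)       = ≡ᵇ≡true⇒≡ (∧-true⁻ (∧-true⁻ {share zero k ≡ᵇ 1} rainbow-k .proj₂) .proj₁)
      share≡1 (suc (suc zero)) = ≡ᵇ≡true⇒≡ (∧-true⁻ (∧-true⁻ {share zero k ≡ᵇ 1} rainbow-k .proj₂) .proj₂)
      member : ∀ i → ∃ λ v → T k v ∧ part i v ≡ true
      member i = count-witness (λ v → T k v ∧ part i v) (subst (0 <_) (sym (share≡1 i)) z<s)
      avoids-apex : T k apex ≡ false
      avoids-apex with T k apex in Tapex
      ... | false = refl
      ... | true  = case subst (λ b → 3 ≡ ⟦ b ⟧ + 3) Tapex three≡ of λ ()
        where
        three≡ : 3 ≡ ⟦ T k apex ⟧ + 3
        three≡ = trans (sym (size k)) (trans (count-by-parts (T k)) (cong (⟦ T k apex ⟧ +_) (sum-cong-≗ {3} share≡1)))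

    record Crown (i : Fin 3) (z : Fin m) (k k′ : Fin s) (b c : Fin m) : Set where
      field
        R      : Rainbow k
        R′     : Rainbow k′
        k≢k′   : k ≢ k′
        z∈     : T k z ≡ true
        z∈′    : T k′ z ≡ true
        b∈     : T k b ≡ true
        c∈′    : T k′ c ≡ true
        z-part : part i z ≡ true
        b-part : part (next i) b ≡ true
        c-part : part (next (next i)) c ≡ true

    crown-edge : ∀ {i z k k′ b c} → Crown i z k k′ b c → adj G b c ≡ true
    crown-edge {i} {z} {k} {k′} {b} {c} C with T k c in c∈
    ... | true  = ⊥-elim (k≢k′ (sharing-parts⇒≡ z∈ c∈ b∈ z∈′ c∈′ (vertex-in R′ (next i))
                                  z-part c-part b-part (vertex-part R′ (next i)) (i≢next² i) (i≢next i) (i≢next (next i) ∘ sym)))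
      where
      open Crown C
      open Rainbow
    ... | false = third-dominates-parts z∈ (vertex-in R (next (next i))) b∈ z-part (vertex-part R (next (next i))) b-part
                    (i≢next² i) (i≢next i) (i≢next (next i) ∘ sym)
                    c∈ (independent k′ z c z∈′ c∈′) (part-independent (vertex-part R (next (next i))) c-part)
      where
      open Crown C
      open Rainbow

    crown-unique : ∀ {i z z* k k′ q q′ b c} → Crown i z k k′ b c → Crown i z* q q′ b c → z ≡ z* × k ≡ q × k′ ≡ q′
    crown-unique {i} {z} {z*} {k} {k′} {q} {q′} {b} {c} C D = z≡z* , k≡q , k′≡q′
      where
      open Crown C
      module D = Crown D
      open Rainbow
      j l : Fin 3
      j = next i
      l = next (next i)
      i≢j : i ≢ j
      i≢j = i≢next i
      i≢l : i ≢ l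
      i≢l = i≢next² i
      j≢l : j ≢ l
      j≢l = i≢next (next i)
      xₗ xⱼ : Fin m
      xₗ = vertex R l
      xⱼ = vertex R′ j
      xₗ~z* : z ≢ z* → adj G xₗ z* ≡ true
      xₗ~z* z≢z* with T k z* in z*∈
      ... | true  = ⊥-elim (z≢z* (trans (only R z∈ z-part) (sym (only R z*∈ D.z-part))))
      ... | false = third-dominates-parts z∈ b∈ (vertex-in R l) z-part b-part (vertex-part R l) i≢j i≢l j≢l
                      z*∈ (part-independent z-part D.z-part) (independent q b z* D.b∈ D.z∈)
      xⱼ~z* : z ≢ z* → adj G xⱼ z* ≡ true
      xⱼ~z* z≢z* with T k′ z* in z*∈
      ... | true  = ⊥-elim (z≢z* (trans (only R′ z∈′ z-part) (sym (only R′ z*∈ D.z-part))))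
      ... | false = third-dominates-parts z∈′ c∈′ (vertex-in R′ j) z-part c-part (vertex-part R′ j) i≢l i≢j (j≢l ∘ sym)
                      z*∈ (part-independent z-part D.z-part) (independent q′ c z* D.c∈′ D.z∈′)
      xⱼ~xₗ : adj G xⱼ xₗ ≡ true
      xⱼ~xₗ with T k′ xₗ in xₗ∈
      ... | true  = ⊥-elim (true≢false (subst (λ x → adj G b x ≡ true) (only R′ c∈′ c-part) (crown-edge C))
                                       (subst (λ x → adj G b x ≡ false) (only R′ xₗ∈ (vertex-part R l))
                                         (independent k b xₗ b∈ (vertex-in R l))))
      ... | false = third-dominates-parts z∈′ c∈′ (vertex-in R′ j) z-part c-part (vertex-part R′ j) i≢l i≢j (j≢l ∘ sym)
                      xₗ∈ (independent k z xₗ z∈ (vertex-in R l)) (part-independent c-part (vertex-part R l))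
      z≡z* : z ≡ z*
      z≡z* with z ≟ z*
      ... | yes z≡z* = z≡z*
      ... | no  z≢z* = ⊥-elim (triangle-free z* xₗ xⱼ (trans (Graph.sym G z* xₗ) (xₗ~z* z≢z*))
                                              (trans (Graph.sym G xₗ xⱼ) xⱼ~xₗ)
                                              (trans (Graph.sym G z* xⱼ) (xⱼ~z* z≢z*)))
      k≡q : k ≡ q
      k≡q = sharing-parts⇒≡ z∈ b∈ (vertex-in R l) (subst (λ x → T q x ≡ true) (sym z≡z*) D.z∈) D.b∈ (vertex-in D.R l)
              z-part b-part (vertex-part R l) (vertex-part D.R l) i≢j i≢l j≢l
      k′≡q′ : k′ ≡ q′
      k′≡q′ = sharing-parts⇒≡ z∈′ c∈′ (vertex-in R′ j) (subst (λ x → T q′ x ≡ true) (sym z≡z*) D.z∈′) D.c∈′ (vertex-in D.R′ j)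
                z-part c-part (vertex-part R′ j) (vertex-part D.R′ j) i≢l i≢j (j≢l ∘ sym)

    rainbow-frequency : Fin m → ℕ
    rainbow-frequency z = count (through z rainbow)

    crown : Fin m → Fin s → Fin s → Fin m → Fin m → Bool
    crown z k k′ b c = (through z rainbow k ∧ (through z rainbow ∖ k) k′)
                     ∧ ((T k b ∧ part (next (colour z)) b) ∧ (T k′ c ∧ part (next (next (colour z))) c))

    crown⁻ : ∀ {z k k′ b c} → crown z k k′ b c ≡ true → Crown (colour z) z k k′ b c
    crown⁻ {z} {k} {k′} {b} {c} crown-true =
      let pair , b∈∧c∈ = ∧-true⁻ {through z rainbow k ∧ (through z rainbow ∖ k) k′} crown-true
          k∈ , k′∈     = ∧-true⁻ {through z rainbow k} pair
          z∈ , rk      = ∧-true⁻ {T k z} k∈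
          z∈′ , rk′    = ∧-true⁻ {T k′ z} (∖-⊆ (through z rainbow) k′∈)
          b∈ , c∈      = ∧-true⁻ {T k b ∧ part (next (colour z)) b} b∈∧c∈
          Tb , b-part  = ∧-true⁻ {T k b} b∈
          Tc , c-part  = ∧-true⁻ {T k′ c} c∈
          R            = rainbow⇒Rainbow rk
      in record
        { R = R ; R′ = rainbow⇒Rainbow rk′ ; k≢k′ = ∖-≢ (through z rainbow) k′∈ ∘ sym
        ; z∈ = z∈ ; z∈′ = z∈′ ; b∈ = Tb ; c∈′ = Tc
        ; z-part = part⁺ λ z≡apex → true≢false (subst (λ x → T k x ≡ true) z≡apex z∈) (Rainbow.avoids-apex R)
        ; b-part = b-part ; c-part = c-part
        }

    crown-injective : ∀ {z z* k k′ q q′ b c} → crown z k k′ b c ≡ true → crown z* q q′ b c ≡ true →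
                      z ≡ z* × k ≡ q × k′ ≡ q′
    crown-injective {z} {z*} {k} {k′} {q} {q′} {b} {c} e e* =
      crown-unique C (subst (λ i → Crown i z* q q′ b c) (sym same-colour) (crown⁻ e*))
      where
      C = crown⁻ e
      same-colour : colour z ≡ colour z*
      same-colour = next-injective (trans (sym (part⁻ (Crown.b-part C) .proj₂)) (part⁻ (Crown.b-part (crown⁻ e*)) .proj₂))

    crown-exists : ∀ z k k′ → ⟦ through z rainbow k ⟧ * ⟦ (through z rainbow ∖ k) k′ ⟧ ≤ ∑[ b < m ] ∑[ c < m ] ⟦ crown z k k′ b c ⟧
    crown-exists z k k′ = subst (_≤ ∑[ b < m ] ∑[ c < m ] ⟦ crown z k k′ b c ⟧) (⟦∧⟧ (R k) ((R ∖ k) k′))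
      (⟦⟧≤ (R k ∧ (R ∖ k) k′) λ pair →
        let Rk  = rainbow⇒Rainbow (∧-true⁻ {T k z} (∧-true⁻ {R k} pair .proj₁) .proj₂)
            Rk′ = rainbow⇒Rainbow (∧-true⁻ {T k′ z} (∖-⊆ R (∧-true⁻ {R k} pair .proj₂)) .proj₂)
            b = Rainbow.vertex Rk (next (colour z))
            c = Rainbow.vertex Rk′ (next (next (colour z)))
            crown-true : crown z k k′ b c ≡ true
            crown-true = ∧-true⁺ pair (∧-true⁺ (∧-true⁺ (Rainbow.vertex-in Rk _) (Rainbow.vertex-part Rk _))
                                               (∧-true⁺ (Rainbow.vertex-in Rk′ _) (Rainbow.vertex-part Rk′ _)))
        in ≤-trans (≤-reflexive (cong ⟦_⟧ (sym crown-true)))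
                   (≤-trans (term≤∑ (λ c → ⟦ crown z k k′ b c ⟧) c) (term≤∑ (λ b → ∑[ c < m ] ⟦ crown z k k′ b c ⟧) b)))
      where
      R : Fin s → Bool
      R = through z rainbow

    crowns-on-edge : ∀ b c → ∑[ z < m ] ∑[ k < s ] count (λ k′ → crown z k k′ b c) ≤ ⟦ adj G b c ⟧
    crowns-on-edge b c with adj G b c in b~c
    ... | true  = ∑∑count-≤1 (λ z k k′ → crown z k k′ b c) crown-injective
    ... | false = ≮⇒≥ λ positive →
      let _ , _ , _ , crown-true = ∑∑count-witness (λ z k k′ → crown z k k′ b c) positive in
      true≢false (crown-edge (crown⁻ crown-true)) b~c

    ∑-rainbow-pairs≤E : ∑[ z < m ] (rainbow-frequency z * (rainbow-frequency z ∸ 1)) ≤ E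
    ∑-rainbow-pairs≤E = begin
      ∑[ z < m ] (rainbow-frequency z * (rainbow-frequency z ∸ 1))
                                    ≡⟨ sum-cong-≗ {m} (λ z → trans (sym (∑-ordered-pairs (R z)))
                                         (sum-cong-≗ {s} λ k → *-distribˡ-sum ⟦ R z k ⟧ (λ k′ → ⟦ (R z ∖ k) k′ ⟧))) ⟩
      ∑[ z < m ] ∑[ k < s ] ∑[ k′ < s ] (⟦ R z k ⟧ * ⟦ (R z ∖ k) k′ ⟧)
                                    ≤⟨ ∑-mono-≤ (λ z → ∑-mono-≤ λ k → ∑-mono-≤ (crown-exists z k)) ⟩
      ∑[ z < m ] ∑[ k < s ] ∑[ k′ < s ] ∑[ b < m ] ∑[ c < m ] ⟦ crown z k k′ b c ⟧
                                    ≡⟨ sum-cong-≗ {m} (λ z → ∑-comm₄ (λ k k′ b c → ⟦ crown z k k′ b c ⟧)) ⟩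
      ∑[ z < m ] ∑[ b < m ] ∑[ c < m ] ∑[ k < s ] count (λ k′ → crown z k k′ b c)
                                    ≡⟨ ∑-comm (λ z b → ∑[ c < m ] ∑[ k < s ] count (λ k′ → crown z k k′ b c)) ⟩
      ∑[ b < m ] ∑[ z < m ] ∑[ c < m ] ∑[ k < s ] count (λ k′ → crown z k k′ b c)
                                    ≡⟨ sum-cong-≗ {m} (λ b → ∑-comm (λ z c → ∑[ k < s ] count (λ k′ → crown z k k′ b c))) ⟩
      ∑[ b < m ] ∑[ c < m ] ∑[ z < m ] ∑[ k < s ] count (λ k′ → crown z k k′ b c)
                                    ≤⟨ ∑-mono-≤ (λ b → ∑-mono-≤ (crowns-on-edge b)) ⟩
      ∑[ b < m ] ∑[ c < m ] ⟦ adj G b c ⟧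
                                    ∎
      where
      open ≤-Reasoning
      R : Fin m → Fin s → Bool
      R z = through z rainbow

    rainbow-hits : ℕ
    rainbow-hits = ∑[ z < m ] (⟦ high z ⟧ * rainbow-frequency z)

    rainbow-hits² : rainbow-hits * rainbow-hits ≤ h * (E + 3 * rainbow-hits)
    rainbow-hits² = begin
      rainbow-hits * rainbow-hits                            ≤⟨ cauchy-schwarz (⟦_⟧ ∘ high) rainbow-frequency ⟩
      h * ∑[ z < m ] (⟦ high z ⟧ * (t z * t z))              ≤⟨ *-monoʳ-≤ h (∑-mono-≤ λ z → ⟦⟧*-≤ (high z) (t z * t z)) ⟩
      h * ∑[ z < m ] (t z * t z)                             ≡⟨ cong (h *_) (trans (sum-cong-≗ {m} (n²≡n[n∸1]+n ∘ t))
                                                                  (∑-distrib-+ (λ z → t z * (t z ∸ 1)) t)) ⟩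
      h * (∑[ z < m ] (t z * (t z ∸ 1)) + ∑[ z < m ] t z)   ≤⟨ *-monoʳ-≤ h (+-mono-≤ ∑-rainbow-pairs≤E (begin
        ∑[ z < m ] t z                                            ≡⟨ ∑-through rainbow ⟩
        3 * count rainbow                                         ≤⟨ *-monoʳ-≤ 3 (count≤via-high rainbow) ⟩
        3 * rainbow-hits                                          ∎)) ⟩
      h * (E + 3 * rainbow-hits)                             ∎
      where
      open ≤-Reasoning
      t : Fin m → ℕ
      t = rainbow-frequency

    frequency-quadratic : M ≤ E → M * (frequency apex * frequency apex) ≤ 4 * (E * E) + 1 * (E * frequency apex)
    frequency-quadratic M≤E = begin
      M * (f * f)                        ≡⟨ cong (M *_) (n²≡n[n∸1]+n f) ⟩
      M * (f * (f ∸ 1) + f)              ≡⟨ *-distribˡ-+ M (f * (f ∸ 1)) f ⟩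
      M * (f * (f ∸ 1)) + M * f          ≤⟨ +-mono-≤ (*-mono-≤ M≤E (frequency-bound apex)) (*-monoˡ-≤ f M≤E) ⟩
      E * (4 * E) + E * f                ≡⟨ regroup E f ⟩
      4 * (E * E) + 1 * (E * f)          ∎
      where
      open ≤-Reasoning
      f : ℕ
      f = frequency apex
      regroup : ∀ E f → E * (4 * E) + E * f ≡ 4 * (E * E) + 1 * (E * f)
      regroup = solve-∀

    pairIn-quadratic : ∀ i → M * (count (pairIn i) * count (pairIn i)) ≤ 6 * (E * E) + 15 * (E * count (pairIn i))
    pairIn-quadratic i = begin
      M * (N * N)                          ≡⟨ regroup M N ⟩
      N * (N * M)                          ≤⟨ *-monoʳ-≤ N (*-monoˡ-≤ M pairIn-bound₂) ⟩
      N * (h * (2 * n + 1) * M)            ≡⟨ regroup′ N h (2 * n + 1) M ⟩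
      h * M * (N * (2 * n + 1))            ≤⟨ *-mono-≤ h*M≤3E (*-monoʳ-≤ N (2n+1≤ n)) ⟩
      3 * E * (N * (2 * (n ∸ 2) + 5))      ≡⟨ cong (3 * E *_) (trans (*-distribˡ-+ N (2 * (n ∸ 2)) 5) (cong (_+ N * 5) (regroup″ N (n ∸ 2)))) ⟩
      3 * E * (2 * (N * (n ∸ 2)) + N * 5)  ≤⟨ *-monoʳ-≤ (3 * E) (+-monoˡ-≤ (N * 5) (*-monoʳ-≤ 2 pairIn-bound₁)) ⟩
      3 * E * (2 * E + N * 5)              ≡⟨ expand E N ⟩
      6 * (E * E) + 15 * (E * N)           ∎
      where
      open ≤-Reasoning
      N n : ℕ
      N = count (pairIn i)
      n = part-size i
      2n+1≤ : ∀ n → 2 * n + 1 ≤ 2 * (n ∸ 2) + 5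
      2n+1≤ zero            = s≤s z≤n
      2n+1≤ (suc zero)      = s≤s (s≤s (s≤s z≤n))
      2n+1≤ (suc (suc n))   = ≤-reflexive (lemma n)
        where
        lemma : ∀ n → 2 * (2 + n) + 1 ≡ 2 * n + 5
        lemma = solve-∀
      regroup : ∀ M N → M * (N * N) ≡ N * (N * M)
      regroup = solve-∀
      regroup′ : ∀ N h a M → N * (h * a * M) ≡ h * M * (N * a)
      regroup′ = solve-∀
      regroup″ : ∀ N d → N * (2 * d) ≡ 2 * (N * d)
      regroup″ = solve-∀
      expand : ∀ E N → 3 * E * (2 * E + N * 5) ≡ 6 * (E * E) + 15 * (E * N)
      expand = solve-∀

    allIn-quadratic : M ≤ E → ∀ i → M * (count (allIn i) * count (allIn i)) ≤ 0 * (E * E) + 1 * (E * count (allIn i))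
    allIn-quadratic M≤E i = begin
      M * (C * C)             ≤⟨ *-monoʳ-≤ M (C²≤C count-allIn≤1) ⟩
      M * C                   ≤⟨ *-monoˡ-≤ C M≤E ⟩
      E * C                   ≡⟨ +-identityʳ (E * C) ⟨
      1 * (E * C)             ∎
      where
      open ≤-Reasoning
      C = count (allIn i)
      C²≤C : ∀ {C} → C ≤ 1 → C * C ≤ C
      C²≤C z≤n       = z≤n
      C²≤C (s≤s z≤n) = s≤s z≤n

    rainbow-quadratic : M * (rainbow-hits * rainbow-hits) ≤ 3 * (E * E) + 9 * (E * rainbow-hits)
    rainbow-quadratic = begin
      M * (X * X)                  ≤⟨ *-monoʳ-≤ M rainbow-hits² ⟩
      M * (h * (E + 3 * X))        ≡⟨ regroup M h (E + 3 * X) ⟩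
      h * M * (E + 3 * X)          ≤⟨ *-monoˡ-≤ (E + 3 * X) h*M≤3E ⟩
      3 * E * (E + 3 * X)          ≡⟨ expand E X ⟩
      3 * (E * E) + 9 * (E * X)    ∎
      where
      open ≤-Reasoning
      X : ℕ
      X = rainbow-hits
      regroup : ∀ M h a → M * (h * a) ≡ h * M * a
      regroup = solve-∀
      expand : ∀ E X → 3 * E * (E + 3 * X) ≡ 3 * (E * E) + 9 * (E * X)
      expand = solve-∀

    open RootScale M E

    s√M≤25E : 21 < M → M ≤ E → s √M≤ 25 E
    s√M≤25E 21<M M≤E = √M≤-mono s≤terms (√M≤-+ (√M≤-+ (√M≤-+ frequency-term pairIn-terms) allIn-terms) rainbow-term)
      where
      s≤terms : s ≤ frequency apex + ∑[ i < 3 ] count (pairIn i) + ∑[ i < 3 ] count (allIn i) + rainbow-hits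
      s≤terms = ≤-trans s≤by-type (+-monoʳ-≤ _ (count≤via-high rainbow))
      frequency-term : frequency apex √M≤ 3 E
      frequency-term = quadratic⇒√M≤ 4 1 (≤-trans (m≤m+n 6 16) 21<M) (m≤m+n 5 4) (frequency-quadratic M≤E)
      pairIn-terms : ∑[ i < 3 ] count (pairIn i) √M≤ ∑[ i < 3 ] 5 E
      pairIn-terms = √M≤-∑ {α = λ _ → 5} λ i → quadratic⇒√M≤ 6 15 21<M (m≤m+n 21 4) (pairIn-quadratic i)
      allIn-terms : ∑[ i < 3 ] count (allIn i) √M≤ ∑[ i < 3 ] 1 E
      allIn-terms = √M≤-∑ {α = λ _ → 1} λ i → quadratic⇒√M≤ 0 1 (≤-trans (m≤m+n 2 20) 21<M) ≤-refl (allIn-quadratic M≤E i)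
      rainbow-term : rainbow-hits √M≤ 4 E
      rainbow-term = quadratic⇒√M≤ 3 9 (≤-trans (m≤m+n 13 9) 21<M) (m≤m+n 12 4) rainbow-quadratic

  module Colouring {k a b c} (Ta : T k a ≡ true) (Tb : T k b ≡ true) (Tc : T k c ≡ true)
                   (a≢b : a ≢ b) (a≢c : a ≢ c) (b≢c : b ≢ c) where

    colour : Fin m → Fin 3
    colour v = if adj G a v then zero else if adj G b v ∨ does (v ≟ a) then suc zero else suc (suc zero)

    colour-0 : ∀ {v} → colour v ≡ zero → adj G a v ≡ true
    colour-0 {v} c0 with adj G a v
    ... | true = refl
    ... | false with adj G b v ∨ does (v ≟ a)
    ...   | true  with () ← c0
    ...   | false with () ← c0

    colour-1 : ∀ {v} → colour v ≡ suc zero → adj G a v ≡ false × (adj G b v ≡ true ⊎ v ≡ a)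
    colour-1 {v} c1 with adj G a v
    ... | true with () ← c1
    ... | false with adj G b v in b~v | v ≟ a
    ...   | true  | _        = refl , inj₁ refl
    ...   | false | yes v≡a  = refl , inj₂ v≡a
    ...   | false | no _     with () ← c1

    colour-2 : ∀ {v} → v ≢ c → colour v ≡ suc (suc zero) → adj G b v ≡ false × (adj G c v ≡ true ⊎ v ≡ b)
    colour-2 {v} v≢c c2 with adj G a v in a~v
    ... | true with () ← c2
    ... | false with adj G b v in b~v | v ≟ a
    ...   | true  | _       with () ← c2
    ...   | false | yes _   with () ← c2
    ...   | false | no v≢a  with T k v in Tv
    ...     | false = refl , inj₁ (third-dominates k Ta Tb Tc a≢b a≢c b≢c Tv a~v b~v)
    ...     | true  with only-members k Ta Tb Tc a≢b a≢c b≢c v Tv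
    ...       | inj₁ v≡a        = ⊥-elim (v≢a v≡a)
    ...       | inj₂ (inj₁ v≡b) = refl , inj₂ v≡b
    ...       | inj₂ (inj₂ v≡c) = ⊥-elim (v≢c v≡c)

    -- Each colour class lies in N(w) ∪ {w′} for a vertex w′ with no neighbour in the class.
    near : ∀ {w w′ u v} → (adj G w u ≡ true ⊎ u ≡ w′) → (adj G w v ≡ true ⊎ v ≡ w′) →
           adj G w′ u ≡ false → adj G w′ v ≡ false → adj G u v ≡ true → ⊥
    near {w} {u = u} {v} (inj₁ w~u) (inj₁ w~v) _ _ u~v = triangle-free w u v w~u u~v w~v
    near {u = u} {v} (inj₁ _) (inj₂ refl) w′≁u _ u~v = true≢false (trans (Graph.sym G v u) u~v) w′≁u
    near (inj₂ refl) _ _ w′≁v u~v = true≢false u~v w′≁v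

    proper : ∀ {u v} → u ≢ c → v ≢ c → colour u ≡ colour v → adj G u v ≡ false
    proper {u} {v} u≢c v≢c same with adj G u v in u~v
    ... | false = refl
    ... | true with colour u in cu
    ...   | zero           = ⊥-elim (triangle-free a u v (colour-0 cu) u~v (colour-0 (sym same)))
    ...   | suc zero       = let a≁u , u-near = colour-1 cu ; a≁v , v-near = colour-1 (sym same) in
                             ⊥-elim (near u-near v-near a≁u a≁v u~v)
    ...   | suc (suc zero) = let b≁u , u-near = colour-2 u≢c cu ; b≁v , v-near = colour-2 v≢c (sym same) in
                             ⊥-elim (near u-near v-near b≁u b≁v u~v)

  s√M≤25E : 21 < M → Fin s → RootScale._√M≤_E M E s 25
  s√M≤25E 21<M k₀ with count≥3⇒members (T k₀) (≤-reflexive (sym (size k₀)))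
  ... | a , b , c , Ta , Tb , Tc , a≢b , a≢c , b≢c = ThreeParts.s√M≤25E c colour proper 21<M (M≤E k₀)
    where
    open Colouring Ta Tb Tc a≢b a≢c b≢c


-- (3,3)'-systems

lookup-injective : ∀ {A : Set} {xs : List.List A} → Unique xs → ∀ i j → List.lookup xs i ≡ List.lookup xs j → i ≡ j
lookup-injective (_  ∷ _)         zero    zero    _  = refl
lookup-injective (x∉ ∷ _)         zero    (suc j) eq = ⊥-elim (All.lookup x∉ (∈-lookup j) eq)
lookup-injective (x∉ ∷ _)         (suc i) zero    eq = ⊥-elim (All.lookup x∉ (∈-lookup i) (sym eq))
lookup-injective (_  ∷ xs-unique) (suc i) (suc j) eq = cong suc (lookup-injective xs-unique i j eq)

∣∣≡count : ∀ {n} (p : Subset n) → ∣ p ∣ ≡ count (Vec.lookup p)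
∣∣≡count []          = refl
∣∣≡count (true ∷ p)  = cong suc (∣∣≡count p)
∣∣≡count (false ∷ p) = ∣∣≡count p

lookup-ext : ∀ {n} {p q : Subset n} → (∀ i → Vec.lookup p i ≡ Vec.lookup q i) → p ≡ q
lookup-ext {p = p} {q} same = trans (sym (tabulate∘lookup p)) (trans (tabulate-cong same) (tabulate∘lookup q))

module FromSystem {m : ℕ} (S : System33 m) where

  triple : Fin (length (family S)) → Fin m → Bool
  triple k = Vec.lookup (List.lookup (family S) k)

  private
    properties : ∀ k → ∣ List.lookup (family S) k ∣ ≡ 3 × MaximalIndependent (H S) (List.lookup (family S) k)
    properties k = All.lookup (members S) (∈-lookup k)

    size : ∀ k → count (triple k) ≡ 3
    size k = trans (sym (∣∣≡count (List.lookup (family S) k))) (properties k .proj₁)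

    independent : ∀ k u v → triple k u ≡ true → triple k v ≡ true → adj (H S) u v ≡ false
    independent k u v Tu Tv = properties k .proj₂ .proj₁ u v (lookup⇒[]= u _ Tu) (lookup⇒[]= v _ Tv)

    dominating : ∀ k v → triple k v ≡ false → ∃ λ u → triple k u ≡ true × adj (H S) u v ≡ true
    dominating k v Tv with properties k .proj₂ .proj₂ v (λ v∈ → true≢false ([]=⇒lookup v∈) Tv)
    ... | u , u∈ , u~v = u , []=⇒lookup u∈ , u~v

    distinct : ∀ k k′ → (∀ v → triple k v ≡ triple k′ v) → k ≡ k′
    distinct k k′ same = lookup-injective (noRepeats S) k k′ (lookup-ext same)

  open TripleSystem (H S) (triangleFree S) triple size independent dominating distinct public

m≤2[m∸3] : ∀ {m} → 6 ≤ m → m ≤ 2 * (m ∸ 3)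
m≤2[m∸3] 6≤m with d , refl ← m≤n⇒∃[o]m+o≡n 6≤m = subst (6 + d ≤_) (double d) (m≤m+n (6 + d) d)
  where
  double : ∀ d → 6 + d + d ≡ 2 * (3 + d)
  double = solve-∀

rescale : ∀ {m s M e} → m ≤ 2 * M → M * (s * s) ≤ 25 * (e + e) * (25 * (e + e)) → m * s * s ≤ 5000 * e * e
rescale {m} {s} {M} {e} m≤2M M-bound = begin
  m * s * s                                  ≤⟨ *-monoˡ-≤ s (*-monoˡ-≤ s m≤2M) ⟩
  2 * M * s * s                              ≡⟨ regroup M s ⟩
  2 * (M * (s * s))                          ≤⟨ *-monoʳ-≤ 2 M-bound ⟩
  2 * (25 * (e + e) * (25 * (e + e)))        ≡⟨ expand e ⟩
  5000 * e * e                               ∎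
  where
  open ≤-Reasoning
  regroup : ∀ M s → 2 * M * s * s ≡ 2 * (M * (s * s))
  regroup = solve-∀
  expand : ∀ e → 2 * (25 * (e + e) * (25 * (e + e))) ≡ 5000 * e * e
  expand = solve-∀

lemma39 : ∃ λ K → ∃ λ s₀ → 0 < K ×
            (∀ m (S : System33 m) →
               s₀ ≤ length (family S) →
               m * length (family S) * length (family S)
                 ≤ K * edgeCount (H S) * edgeCount (H S))
lemma39 = 5000 , 1153 , s≤s z≤n , bound
  where
  bound : ∀ m (S : System33 m) → 1153 ≤ length (family S) →
          m * length (family S) * length (family S) ≤ 5000 * edgeCount (H S) * edgeCount (H S)
  bound m S 1153≤s = rescale {M = m ∸ 3} {e = edgeCount (H S)} (m≤2[m∸3] (≤-trans (m≤m+n 6 19) 25≤m))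
    (subst (λ E → (m ∸ 3) * (s * s) ≤ 25 * E * (25 * E)) (handshake (H S))
           (RootScale._√M≤_E.squared-bound (s√M≤25E (m+n≤o⇒m≤o∸n 22 25≤m) k₀)))
    where
    open FromSystem S
    s : ℕ
    s = length (family S)
    -- 1153 = 2 · 24² + 1 is the least s₀ for which s ≤ 2m² rules out m ≤ 24.
    25≤m : 25 ≤ m
    25≤m = ≮⇒≥ λ m<25 → <⇒≱ (s≤s (≤-trans triples≤2m² (*-mono-≤ (≤-pred m<25) (*-monoˡ-≤ 2 (≤-pred m<25))))) 1153≤s
    k₀ : Fin s
    k₀ = fromℕ< (≤-trans (s≤s z≤n) 1153≤s)
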